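{- Let $N$ be an odd positive integer and let $N_0$ be a positive divisor of $N$. Then $P_{N_0}(x)$ divides $P_N(x)$.
   Context: The Collatz function is $T(n) = n/2$ if $n$ is even and $T(n) = (3n+1)/2$ if $n$ is odd, for nonnegative integers $n$. For an integer $N \geq 1$ the modular Collatz graph $G_N$ has vertex set $\mathbb{Z}_N = \{0,1,\ldots,N-1\}$ and adjacency matrix $C_N = (c_{i,j})_{0 \le i,j \le N-1}$ with $c_{i,j} = \#\{\nu \in \{i, i+N\} : T(\nu) \equiv j \pmod N\}$; in particular $C_1 = (2)$. $P_N(x) = \det(x I_N - C_N)$ denotes the characteristic polynomial of $C_N$. -}

module Defs where

open import Data.Nat as ℕ using (ℕ; zero; suc; _%_; _/_; _≡ᵇ_)
open import Data.Bool using (Bool; true; false; if_then_else_)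
open import Data.Integer as ℤ using (ℤ; +_)
open import Data.Fin using (Fin; toℕ; punchIn)
import Data.Fin as Fin
open import Data.List using (List; []; _∷_; map)
open import Data.Product using (∃)
open import Relation.Binary.PropositionalEquality using (_≡_)
open import Relation.Nullary using (yes; no)

T : ℕ → ℕ
T n = if n % 2 ≡ᵇ 0 then n / 2 else (3 ℕ.* n ℕ.+ 1) / 2

indicator : Bool → ℕ
indicator true  = 1
indicator false = 0

collatzMatrix : (N : ℕ) → Fin N → Fin N → ℕ
collatzMatrix (suc m) i j =
  indicator (T (toℕ i) % suc m ≡ᵇ toℕ j)
  ℕ.+ indicator (T (toℕ i ℕ.+ suc m) % suc m ≡ᵇ toℕ j)

-- Polynomials with integer coefficients, as coefficient lists
-- (lowest degree first).  Equality is coefficientwise.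

Poly : Set
Poly = List ℤ

coeff : Poly → ℕ → ℤ
coeff []      _       = + 0
coeff (a ∷ p) zero    = a
coeff (a ∷ p) (suc k) = coeff p k

infixl 6 _+P_ _-P_
infixl 7 _*P_
infix 4 _≈P_ _∣P_

_+P_ : Poly → Poly → Poly
[]      +P q       = q
(a ∷ p) +P []      = a ∷ p
(a ∷ p) +P (b ∷ q) = (a ℤ.+ b) ∷ (p +P q)

scaleP : ℤ → Poly → Poly
scaleP a = map (a ℤ.*_)

negP : Poly → Poly
negP = map (λ a → ℤ.- a)

_-P_ : Poly → Poly → Poly
p -P q = p +P negP q

_*P_ : Poly → Poly → Poly
[]      *P q = []
(a ∷ p) *P q = scaleP a q +P (+ 0 ∷ (p *P q))

constP : ℤ → Poly
constP a = a ∷ []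

X : Poly
X = + 0 ∷ + 1 ∷ []

_≈P_ : Poly → Poly → Set
p ≈P q = ∀ k → coeff p k ≡ coeff q k

_∣P_ : Poly → Poly → Set
p ∣P q = ∃ λ r → q ≈P p *P r

sumP : (n : ℕ) → (Fin n → Poly) → Poly
sumP zero    f = []
sumP (suc n) f = f Fin.zero +P sumP n (λ j → f (Fin.suc j))

signP : ℕ → Poly → Poly
signP zero          p = p
signP (suc zero)    p = negP p
signP (suc (suc k)) p = signP k p

det : (n : ℕ) → (Fin n → Fin n → Poly) → Poly
det zero    M = constP (+ 1)
det (suc n) M =
  sumP (suc n) λ j →
    signP (toℕ j)
      (M Fin.zero j *P det n (λ r c → M (Fin.suc r) (punchIn j c)))

identityEntry : {n : ℕ} → Fin n → Fin n → Poly
identityEntry i j with i Fin.≟ j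
... | yes _ = X
... | no  _ = []

charPoly : ℕ → Poly
charPoly N =
  det N (λ i j → identityEntry i j -P constP (+ collatzMatrix N i j))

module Submission where

open import Algebra.Bundles using (CommutativeRing)
open import Defs using (charPoly; _∣P_)
open import Data.Nat using (ℕ; suc; _%_; _<_)
open import Data.Nat.Divisibility using (_∣_; divides)
open import Relation.Binary.PropositionalEquality using (_≡_)

-- Write N = k N₀ with k odd. Reduction modulo N₀ is a covering of G_{N₀} by G_N:
-- for every vertex i and residue c, the entries of row i of C_N over the columns
-- z ≡ c (mod N₀) add up to the entry (i mod N₀, c) of C_{N₀}. Indeed T modulo N₀
-- depends only on its argument modulo 2N₀, and as k is odd the pair {i, i + N} is,
-- modulo 2N₀, the pair {i₀, i₀ + N₀} with i₀ = i mod N₀.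
--
-- Hence in xI − C_N, adding to each of the last N₀ columns the earlier columns of
-- its residue class, and then subtracting from each of the first N − N₀ rows the
-- last-block row of its residue class, produces a block lower triangular matrix
-- with xI − C_{N₀} as its lower diagonal block; so P_{N₀} divides P_N. These
-- operations preserve the determinant, defined by Laplace expansion along the first
-- row, because it is an alternating multilinear function both of the rows and of
-- the columns.

module PolynomialRing where
  open import Defs
  open import Data.Nat using (zero; suc)
  open import Data.Integer as ℤ using (+_)
  import Data.Integer.Properties as ℤ
  open import Data.List using ([]; _∷_)
  open import Data.Product using (_,_)
  open import Level using (0ℓ)
  open import Relation.Binary.Bundles using (Setoid)
  open import Relation.Binary.PropositionalEquality
    using (_≡_; refl; sym; trans; cong; cong₂; module ≡-Reasoning)

  -- `_≈P_` is a function type, which defeats unification of its arguments;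
  -- wrapping it in a record lets the ring laws leave polynomials implicit.
  infix 4 _≃_
  record _≃_ (p q : Poly) : Set where
    constructor coeffwise
    field coeff-≡ : p ≈P q
  open _≃_ public

  coeff-+P : ∀ p q k → coeff (p +P q) k ≡ coeff p k ℤ.+ coeff q k
  coeff-+P []      q       k       = sym (ℤ.+-identityˡ _)
  coeff-+P (a ∷ p) []      k       = sym (ℤ.+-identityʳ _)
  coeff-+P (a ∷ p) (b ∷ q) zero    = refl
  coeff-+P (a ∷ p) (b ∷ q) (suc k) = coeff-+P p q k

  coeff-scaleP : ∀ a p k → coeff (scaleP a p) k ≡ a ℤ.* coeff p k
  coeff-scaleP a []      k       = sym (ℤ.*-zeroʳ a)
  coeff-scaleP a (b ∷ p) zero    = refl
  coeff-scaleP a (b ∷ p) (suc k) = coeff-scaleP a p k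

  coeff-negP : ∀ p k → coeff (negP p) k ≡ ℤ.- coeff p k
  coeff-negP []      k       = refl
  coeff-negP (b ∷ p) zero    = refl
  coeff-negP (b ∷ p) (suc k) = coeff-negP p k

  ≃-refl : ∀ {p} → p ≃ p
  ≃-refl .coeff-≡ k = refl

  ≃-sym : ∀ {p q} → p ≃ q → q ≃ p
  ≃-sym e .coeff-≡ k = sym (e .coeff-≡ k)

  ≃-trans : ∀ {p q r} → p ≃ q → q ≃ r → p ≃ r
  ≃-trans e f .coeff-≡ k = trans (e .coeff-≡ k) (f .coeff-≡ k)

  ≃-setoid : Setoid 0ℓ 0ℓ
  ≃-setoid = record
    { Carrier       = Poly
    ; _≈_           = _≃_
    ; isEquivalence = record { refl = ≃-refl ; sym = ≃-sym ; trans = ≃-trans }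
    }

  ∷-cong : ∀ {a b p q} → a ≡ b → p ≃ q → (a ∷ p) ≃ (b ∷ q)
  ∷-cong a≡b e .coeff-≡ zero    = a≡b
  ∷-cong a≡b e .coeff-≡ (suc k) = e .coeff-≡ k

  tail-≃ : ∀ {a b p q} → (a ∷ p) ≃ (b ∷ q) → p ≃ q
  tail-≃ e .coeff-≡ k = e .coeff-≡ (suc k)

  +P-cong : ∀ {p p′ q q′} → p ≃ p′ → q ≃ q′ → p +P q ≃ p′ +P q′
  +P-cong {p} {p′} {q} {q′} e f .coeff-≡ k = begin
    coeff (p +P q) k            ≡⟨ coeff-+P p q k ⟩
    coeff p k ℤ.+ coeff q k     ≡⟨ cong₂ ℤ._+_ (e .coeff-≡ k) (f .coeff-≡ k) ⟩
    coeff p′ k ℤ.+ coeff q′ k   ≡⟨ coeff-+P p′ q′ k ⟨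
    coeff (p′ +P q′) k          ∎
    where open ≡-Reasoning

  +P-assoc : ∀ p q r → (p +P q) +P r ≃ p +P (q +P r)
  +P-assoc p q r .coeff-≡ k = begin
    coeff ((p +P q) +P r) k                   ≡⟨ coeff-+P (p +P q) r k ⟩
    coeff (p +P q) k ℤ.+ coeff r k            ≡⟨ cong (ℤ._+ coeff r k) (coeff-+P p q k) ⟩
    (coeff p k ℤ.+ coeff q k) ℤ.+ coeff r k   ≡⟨ ℤ.+-assoc (coeff p k) _ _ ⟩
    coeff p k ℤ.+ (coeff q k ℤ.+ coeff r k)   ≡⟨ cong (ℤ._+_ (coeff p k)) (coeff-+P q r k) ⟨
    coeff p k ℤ.+ coeff (q +P r) k            ≡⟨ coeff-+P p (q +P r) k ⟨
    coeff (p +P (q +P r)) k                   ∎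
    where open ≡-Reasoning

  +P-comm : ∀ p q → p +P q ≃ q +P p
  +P-comm p q .coeff-≡ k =
    trans (coeff-+P p q k) (trans (ℤ.+-comm (coeff p k) _) (sym (coeff-+P q p k)))

  +P-identityʳ : ∀ p → p +P [] ≃ p
  +P-identityʳ p .coeff-≡ k = trans (coeff-+P p [] k) (ℤ.+-identityʳ _)

  negP-inverseˡ : ∀ p → negP p +P p ≃ []
  negP-inverseˡ p .coeff-≡ k =
    trans (coeff-+P (negP p) p k)
      (trans (cong (ℤ._+ coeff p k) (coeff-negP p k)) (ℤ.+-inverseˡ (coeff p k)))

  negP-inverseʳ : ∀ p → p +P negP p ≃ []
  negP-inverseʳ p = ≃-trans (+P-comm p (negP p)) (negP-inverseˡ p)

  negP-cong : ∀ {p q} → p ≃ q → negP p ≃ negP q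
  negP-cong {p} {q} e .coeff-≡ k =
    trans (coeff-negP p k) (trans (cong ℤ.-_ (e .coeff-≡ k)) (sym (coeff-negP q k)))

  scaleP-cong : ∀ a {p q} → p ≃ q → scaleP a p ≃ scaleP a q
  scaleP-cong a {p} {q} e .coeff-≡ k =
    trans (coeff-scaleP a p k) (trans (cong (a ℤ.*_) (e .coeff-≡ k)) (sym (coeff-scaleP a q k)))

  scaleP-distrib-+P : ∀ a p q → scaleP a (p +P q) ≃ scaleP a p +P scaleP a q
  scaleP-distrib-+P a p q .coeff-≡ k = begin
    coeff (scaleP a (p +P q)) k                     ≡⟨ coeff-scaleP a (p +P q) k ⟩
    a ℤ.* coeff (p +P q) k                          ≡⟨ cong (a ℤ.*_) (coeff-+P p q k) ⟩
    a ℤ.* (coeff p k ℤ.+ coeff q k)                 ≡⟨ ℤ.*-distribˡ-+ a (coeff p k) _ ⟩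
    a ℤ.* coeff p k ℤ.+ a ℤ.* coeff q k             ≡⟨ cong₂ ℤ._+_ (coeff-scaleP a p k) (coeff-scaleP a q k) ⟨
    coeff (scaleP a p) k ℤ.+ coeff (scaleP a q) k   ≡⟨ coeff-+P (scaleP a p) (scaleP a q) k ⟨
    coeff (scaleP a p +P scaleP a q) k              ∎
    where open ≡-Reasoning

  scaleP-zero : ∀ p → scaleP (+ 0) p ≃ []
  scaleP-zero p .coeff-≡ k = trans (coeff-scaleP (+ 0) p k) (ℤ.*-zeroˡ (coeff p k))

  scaleP-one : ∀ p → scaleP (+ 1) p ≃ p
  scaleP-one p .coeff-≡ k = trans (coeff-scaleP (+ 1) p k) (ℤ.*-identityˡ (coeff p k))

  scaleP-scaleP : ∀ a b p → scaleP a (scaleP b p) ≃ scaleP (a ℤ.* b) p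
  scaleP-scaleP a b p .coeff-≡ k = begin
    coeff (scaleP a (scaleP b p)) k   ≡⟨ coeff-scaleP a (scaleP b p) k ⟩
    a ℤ.* coeff (scaleP b p) k        ≡⟨ cong (a ℤ.*_) (coeff-scaleP b p k) ⟩
    a ℤ.* (b ℤ.* coeff p k)           ≡⟨ ℤ.*-assoc a b _ ⟨
    a ℤ.* b ℤ.* coeff p k             ≡⟨ coeff-scaleP (a ℤ.* b) p k ⟨
    coeff (scaleP (a ℤ.* b) p) k      ∎
    where open ≡-Reasoning

  +P-interchange : ∀ w x y z → (w +P x) +P (y +P z) ≃ (w +P y) +P (x +P z)
  +P-interchange w x y z =
    ≃-trans (+P-assoc w x _)
      (≃-trans (+P-cong (≃-refl {w}) (≃-trans (≃-sym (+P-assoc x y z))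
        (≃-trans (+P-cong (+P-comm x y) ≃-refl) (+P-assoc y x z))))
      (≃-sym (+P-assoc w y _)))

  *P-congʳ : ∀ p {q q′} → q ≃ q′ → p *P q ≃ p *P q′
  *P-congʳ []      e = ≃-refl
  *P-congʳ (a ∷ p) e = +P-cong (scaleP-cong a e) (∷-cong refl (*P-congʳ p e))

  *P-zeroˡ : ∀ {p} q → p ≃ [] → p *P q ≃ []
  *P-zeroˡ {[]}    q e = ≃-refl
  *P-zeroˡ {a ∷ p} q e =
    ≃-trans (+P-cong (≃-trans (scaleP-cong′ (e .coeff-≡ zero)) (scaleP-zero q))
                     (∷-cong refl (*P-zeroˡ {p} q (coeffwise λ k → e .coeff-≡ (suc k)))))
            (coeffwise λ { zero → refl ; (suc k) → refl })
    where
    scaleP-cong′ : ∀ {a b} → a ≡ b → scaleP a q ≃ scaleP b q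
    scaleP-cong′ refl = ≃-refl

  *P-congˡ : ∀ {p p′} q → p ≃ p′ → p *P q ≃ p′ *P q
  *P-congˡ {[]}    {p′}     q e = ≃-sym (*P-zeroˡ q (≃-sym e))
  *P-congˡ {a ∷ p} {[]}     q e = *P-zeroˡ q e
  *P-congˡ {a ∷ p} {b ∷ p′} q e with e .coeff-≡ zero
  ... | refl = +P-cong ≃-refl (∷-cong refl (*P-congˡ q (tail-≃ e)))

  *P-distribˡ-+P : ∀ p q r → p *P (q +P r) ≃ p *P q +P p *P r
  *P-distribˡ-+P []      q r = ≃-refl
  *P-distribˡ-+P (a ∷ p) q r =
    ≃-trans (+P-cong (scaleP-distrib-+P a q r) (∷-cong refl (*P-distribˡ-+P p q r)))
            (+P-interchange (scaleP a q) (scaleP a r) (+ 0 ∷ (p *P q)) (+ 0 ∷ (p *P r)))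

  *P-∷ʳ : ∀ p b q → p *P (b ∷ q) ≃ scaleP b p +P (+ 0 ∷ (p *P q))
  *P-∷ʳ []      b q = coeffwise λ { zero → refl ; (suc k) → refl }
  *P-∷ʳ (a ∷ p) b q = ∷-cong head (begin
    scaleP a q +P p *P (b ∷ q)                           ≈⟨ +P-cong (≃-refl {scaleP a q}) (*P-∷ʳ p b q) ⟩
    scaleP a q +P (scaleP b p +P (+ 0 ∷ (p *P q)))       ≈⟨ ≃-sym (+P-assoc (scaleP a q) _ _) ⟩
    (scaleP a q +P scaleP b p) +P (+ 0 ∷ (p *P q))       ≈⟨ +P-cong (+P-comm (scaleP a q) _) ≃-refl ⟩
    (scaleP b p +P scaleP a q) +P (+ 0 ∷ (p *P q))       ≈⟨ +P-assoc (scaleP b p) _ _ ⟩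
    scaleP b p +P (scaleP a q +P (+ 0 ∷ (p *P q)))       ∎)
    where
    open import Relation.Binary.Reasoning.Setoid ≃-setoid
    head : a ℤ.* b ℤ.+ + 0 ≡ b ℤ.* a ℤ.+ + 0
    head = cong (ℤ._+ + 0) (ℤ.*-comm a b)

  *P-zeroʳ : ∀ p → p *P [] ≃ []
  *P-zeroʳ []                       = ≃-refl
  *P-zeroʳ (a ∷ p) .coeff-≡ zero    = refl
  *P-zeroʳ (a ∷ p) .coeff-≡ (suc k) = *P-zeroʳ p .coeff-≡ k

  *P-comm : ∀ p q → p *P q ≃ q *P p
  *P-comm []      q = ≃-sym (*P-zeroʳ q)
  *P-comm (a ∷ p) q = ≃-trans (+P-cong ≃-refl (∷-cong refl (*P-comm p q))) (≃-sym (*P-∷ʳ q a p))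

  *P-distribʳ-+P : ∀ p q r → (q +P r) *P p ≃ q *P p +P r *P p
  *P-distribʳ-+P p q r =
    ≃-trans (*P-comm (q +P r) p)
      (≃-trans (*P-distribˡ-+P p q r) (+P-cong (*P-comm p q) (*P-comm p r)))

  scaleP-*P : ∀ a q r → scaleP a q *P r ≃ scaleP a (q *P r)
  scaleP-*P a []      r = ≃-refl
  scaleP-*P a (b ∷ q) r = begin
    scaleP (a ℤ.* b) r +P (+ 0 ∷ (scaleP a q *P r))        ≈⟨ +P-cong (≃-sym (scaleP-scaleP a b r)) (∷-cong refl (scaleP-*P a q r)) ⟩
    scaleP a (scaleP b r) +P (+ 0 ∷ scaleP a (q *P r))     ≈⟨ +P-cong (≃-refl {scaleP a (scaleP b r)}) (∷-cong (sym (ℤ.*-zeroʳ a)) ≃-refl) ⟩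
    scaleP a (scaleP b r) +P scaleP a (+ 0 ∷ (q *P r))     ≈⟨ ≃-sym (scaleP-distrib-+P a (scaleP b r) _) ⟩
    scaleP a (scaleP b r +P (+ 0 ∷ (q *P r)))              ∎
    where open import Relation.Binary.Reasoning.Setoid ≃-setoid

  *P-assoc : ∀ p q r → (p *P q) *P r ≃ p *P (q *P r)
  *P-assoc []      q r = ≃-refl
  *P-assoc (a ∷ p) q r =
    ≃-trans (*P-distribʳ-+P r (scaleP a q) (+ 0 ∷ (p *P q)))
      (+P-cong (scaleP-*P a q r) (≃-trans (shift-*P (p *P q)) (∷-cong refl (*P-assoc p q r))))
    where
    shift-*P : ∀ s → (+ 0 ∷ s) *P r ≃ + 0 ∷ (s *P r)
    shift-*P s = +P-cong (scaleP-zero r) ≃-refl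

  *P-identityˡ : ∀ p → constP (+ 1) *P p ≃ p
  *P-identityˡ p =
    ≃-trans (+P-cong (scaleP-one p) (coeffwise λ { zero → refl ; (suc k) → refl }))
            (+P-identityʳ p)

  *P-identityʳ : ∀ p → p *P constP (+ 1) ≃ p
  *P-identityʳ p = ≃-trans (*P-comm p _) (*P-identityˡ p)

  Poly-commutativeRing : CommutativeRing 0ℓ 0ℓ
  Poly-commutativeRing = record
    { Carrier           = Poly
    ; _≈_               = _≃_
    ; _+_               = _+P_
    ; _*_               = _*P_
    ; -_                = negP
    ; 0#                = []
    ; 1#                = constP (+ 1)
    ; isCommutativeRing = record
      { isRing = record
        { +-isAbelianGroup = record
          { isGroup = record
            { isMonoid = record
              { isSemigroup = record
                { isMagma = record
                  { isEquivalence = Setoid.isEquivalence ≃-setoid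
                  ; ∙-cong        = +P-cong
                  }
                ; assoc = +P-assoc
                }
              ; identity = (λ _ → ≃-refl) , +P-identityʳ
              }
            ; inverse = negP-inverseˡ , negP-inverseʳ
            ; ⁻¹-cong = negP-cong
            }
          ; comm = +P-comm
          }
        ; *-cong     = λ {p} {p′} {q} {q′} e f → ≃-trans (*P-congˡ q e) (*P-congʳ p′ f)
        ; *-assoc    = *P-assoc
        ; *-identity = *P-identityˡ , *P-identityʳ
        ; distrib    = *P-distribˡ-+P , *P-distribʳ-+P
        }
      ; *-comm = *P-comm
      }
    }

module Determinant {c ℓ} (R : CommutativeRing c ℓ) where
  open import Data.Nat as ℕ using (ℕ; zero; suc)
  import Data.Nat.Properties as ℕₚ
  open import Data.Fin as Fin using (Fin; zero; suc; toℕ; punchIn; punchOut; _↑ˡ_; _↑ʳ_)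
  import Data.Fin.Properties as Fin
  open import Data.Empty using (⊥-elim)
  open import Data.Product using (_×_; _,_)
  open import Relation.Binary.Definitions using (tri<; tri≈; tri>)
  open import Data.Sum using (_⊎_; inj₁; inj₂)
  open import Level using (_⊔_)
  open import Function using (_∘_)
  open import Relation.Nullary using (yes; no)
  open import Relation.Binary.PropositionalEquality as ≡ using (_≡_; _≢_)

  open CommutativeRing R renaming (Carrier to A) hiding (zero)
  open import Algebra.Properties.Ring ring
    using (-0#≈0#; -‿involutive; -‿+-comm; -‿distribʳ-*; +-inverseʳ-unique)
  open import Algebra.Properties.Semiring.Sum semiring
    using (sum; sum-syntax; sum-cong-≋; sum-remove; sum-replicate-zero; ∑-distrib-+; *-distribˡ-sum)
  open import Algebra.Properties.CommutativeSemigroup *-commutativeSemigroup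
    using (x∙yz≈y∙xz)
  open import Relation.Binary.Reasoning.Setoid setoid

  private
    variable
      m n : ℕ

  ∑-zero : {f : Fin n → A} → (∀ j → f j ≈ 0#) → sum f ≈ 0#
  ∑-zero {n} f≈0 = trans (sum-cong-≋ f≈0) (sum-replicate-zero n)

  ∑-neg : (f : Fin n → A) → ∑[ j < n ] (- f j) ≈ - sum f
  ∑-neg {zero}  f = sym -0#≈0#
  ∑-neg {suc n} f = trans (+-congˡ (∑-neg (f ∘ suc))) (-‿+-comm (f zero) _)

  ∑-single : (f : Fin n → A) (j : Fin n) → (∀ k → k ≢ j → f k ≈ 0#) → sum f ≈ f j
  ∑-single {suc n} f j others≈0 = begin
    sum f                                  ≈⟨ sum-remove f ⟩
    f j + ∑[ k < n ] (f (punchIn j k))     ≈⟨ +-congˡ (∑-zero λ k → others≈0 _ (Fin.punchInᵢ≢i j k)) ⟩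
    f j + 0#                               ≈⟨ +-identityʳ (f j) ⟩
    f j                                    ∎

  punchIn≢ : {j c : Fin (suc n)} (j≢c : j ≢ c) {x : Fin n} → x ≢ punchOut j≢c → punchIn j x ≢ c
  punchIn≢ {j = j} j≢c {x} x≢ eq =
    x≢ (Fin.punchIn-injective j x _ (≡.trans eq (≡.sym (Fin.punchIn-punchOut j≢c))))

  ∑-cancel-pair : (f : Fin n → A) {a b : Fin n} → a ≢ b →
    (∀ j → j ≢ a → j ≢ b → f j ≈ 0#) → f b ≈ - f a → sum f ≈ 0#
  ∑-cancel-pair {suc n} f {a} {b} a≢b others≈0 fb≈-fa = begin
    sum f                              ≈⟨ sum-remove f ⟩
    f a + ∑[ k < n ] (f (punchIn a k)) ≈⟨ +-congˡ (∑-single _ b′ λ k k≢b′ →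
                                            others≈0 _ (Fin.punchInᵢ≢i a k) (punchIn≢ a≢b k≢b′)) ⟩
    f a + f (punchIn a b′)             ≈⟨ +-congˡ (reflexive (≡.cong f (Fin.punchIn-punchOut a≢b))) ⟩
    f a + f b                          ≈⟨ +-congˡ fb≈-fa ⟩
    f a + - f a                        ≈⟨ -‿inverseʳ (f a) ⟩
    0#                                 ∎
    where b′ = punchOut a≢b

  ∑-split : (f : Fin (m ℕ.+ n) → A) →
    sum f ≈ ∑[ i < m ] (f (i ↑ˡ n)) + ∑[ j < n ] (f (m ↑ʳ j))
  ∑-split {zero}  f = sym (+-identityˡ _)
  ∑-split {suc m} {n} f = trans (+-congˡ (∑-split {m} {n} (f ∘ suc))) (sym (+-assoc _ _ _))

  sign : ℕ → A → A
  sign zero          x = x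
  sign (suc zero)    x = - x
  sign (suc (suc k)) x = sign k x

  sign-cong : ∀ k {x y} → x ≈ y → sign k x ≈ sign k y
  sign-cong zero          x≈y = x≈y
  sign-cong (suc zero)    x≈y = -‿cong x≈y
  sign-cong (suc (suc k)) x≈y = sign-cong k x≈y

  sign-suc : ∀ k x → sign (suc k) x ≈ - sign k x
  sign-suc zero          x = refl
  sign-suc (suc zero)    x = sym (-‿involutive x)
  sign-suc (suc (suc k)) x = sign-suc k x

  sign-neg : ∀ k x → sign k (- x) ≈ - sign k x
  sign-neg zero          x = refl
  sign-neg (suc zero)    x = refl
  sign-neg (suc (suc k)) x = sign-neg k x

  sign-+ : ∀ k x y → sign k (x + y) ≈ sign k x + sign k y
  sign-+ zero          x y = refl
  sign-+ (suc zero)    x y = sym (-‿+-comm x y)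
  sign-+ (suc (suc k)) x y = sign-+ k x y

  sign-* : ∀ k x y → sign k (x * y) ≈ x * sign k y
  sign-* zero          x y = refl
  sign-* (suc zero)    x y = -‿distribʳ-* x y
  sign-* (suc (suc k)) x y = sign-* k x y

  sign-zero : ∀ k {x} → x ≈ 0# → sign k x ≈ 0#
  sign-zero k {x} x≈0 = trans (sign-cong k (trans x≈0 (sym (zeroˡ x)))) (trans (sign-* k 0# x) (zeroˡ _))

  sign-sum : ∀ k (f : Fin n → A) → sign k (sum f) ≈ ∑[ j < n ] (sign k (f j))
  sign-sum {zero}  k f = sign-zero k refl
  sign-sum {suc n} k f = trans (sign-+ k _ _) (+-congˡ (sign-sum k (f ∘ suc)))

  Matrix : ℕ → Set c
  Matrix n = Fin n → Fin n → A

  infix 4 _≈ₘ_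
  _≈ₘ_ : Matrix n → Matrix n → Set ℓ
  M ≈ₘ M′ = ∀ i j → M i j ≈ M′ i j

  transpose : Matrix n → Matrix n
  transpose M i j = M j i

  minor : Fin (suc n) → Matrix (suc n) → Matrix n
  minor j M r c = M (suc r) (punchIn j c)

  det : ∀ n → Matrix n → A
  det zero    M = 1#
  det (suc n) M = ∑[ j < suc n ] (sign (toℕ j) (M zero j * det n (minor j M)))

  laplaceTerm : Matrix (suc n) → Fin (suc n) → A
  laplaceTerm {n} M j = sign (toℕ j) (M zero j * det n (minor j M))

  det-cong : ∀ n {M M′ : Matrix n} → M ≈ₘ M′ → det n M ≈ det n M′
  det-cong zero    M≈M′ = refl
  det-cong (suc n) M≈M′ = sum-cong-≋ λ j →
    sign-cong (toℕ j) (*-cong (M≈M′ zero j) (det-cong n λ r c → M≈M′ (suc r) (punchIn j c)))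

  data Adjacent : Fin n → Fin n → Set where
    adjacent-zero : Adjacent {suc (suc n)} zero (suc zero)
    adjacent-suc  : {a b : Fin n} → Adjacent a b → Adjacent (suc a) (suc b)

  Adjacent⇒toℕ-suc : {a b : Fin n} → Adjacent a b → toℕ b ≡ suc (toℕ a)
  Adjacent⇒toℕ-suc adjacent-zero    = ≡.refl
  Adjacent⇒toℕ-suc (adjacent-suc p) = ≡.cong suc (Adjacent⇒toℕ-suc p)

  Adjacent⇒≢ : {a b : Fin n} → Adjacent a b → a ≢ b
  Adjacent⇒≢ p a≡b = ℕₚ.1+n≢n (≡.trans (≡.sym (Adjacent⇒toℕ-suc p)) (≡.cong toℕ (≡.sym a≡b)))

  toℕ-suc⇒Adjacent : {a b : Fin n} → toℕ b ≡ suc (toℕ a) → Adjacent a b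
  toℕ-suc⇒Adjacent {a = zero}  {suc zero}    _  = adjacent-zero
  toℕ-suc⇒Adjacent {a = zero}  {suc (suc b)} ()
  toℕ-suc⇒Adjacent {a = suc a} {suc b}       eq = adjacent-suc (toℕ-suc⇒Adjacent (ℕₚ.suc-injective eq))

  Adjacent-punchOut : {a b j : Fin (suc n)} → Adjacent a b → (j≢a : j ≢ a) (j≢b : j ≢ b) →
    Adjacent (punchOut j≢a) (punchOut j≢b)
  Adjacent-punchOut {j = zero}                 adjacent-zero    j≢a j≢b = ⊥-elim (j≢a ≡.refl)
  Adjacent-punchOut {j = zero}                 (adjacent-suc p) j≢a j≢b = p
  Adjacent-punchOut {j = suc zero}             adjacent-zero    j≢a j≢b = ⊥-elim (j≢b ≡.refl)
  Adjacent-punchOut {suc (suc n)} {j = suc (suc j)} adjacent-zero j≢a j≢b = adjacent-zero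
  Adjacent-punchOut {suc n} {j = suc j}        (adjacent-suc p) j≢a j≢b =
    adjacent-suc (Adjacent-punchOut p (j≢a ∘ ≡.cong suc) (j≢b ∘ ≡.cong suc))

  punchIn-Adjacent : {a b : Fin (suc n)} → Adjacent a b → (c : Fin n) →
    punchIn a c ≡ punchIn b c ⊎ (punchIn a c ≡ b × punchIn b c ≡ a)
  punchIn-Adjacent adjacent-zero    zero    = inj₂ (≡.refl , ≡.refl)
  punchIn-Adjacent adjacent-zero    (suc c) = inj₁ ≡.refl
  punchIn-Adjacent (adjacent-suc p) zero    = inj₁ ≡.refl
  punchIn-Adjacent (adjacent-suc p) (suc c) with punchIn-Adjacent p c
  ... | inj₁ eq         = inj₁ (≡.cong suc eq)
  ... | inj₂ (eqa , eqb) = inj₂ (≡.cong suc eqa , ≡.cong suc eqb)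

  -- Linearity of det in a row and in a column

  AgreeOffRow : Fin n → Matrix n → Matrix n → Set ℓ
  AgreeOffRow r M M′ = ∀ i j → i ≢ r → M i j ≈ M′ i j

  AgreeOffColumn : Fin n → Matrix n → Matrix n → Set ℓ
  AgreeOffColumn c M M′ = ∀ i j → j ≢ c → M i j ≈ M′ i j

  det-row-additive : ∀ n (r : Fin n) {M M₁ M₂ : Matrix n} →
    AgreeOffRow r M M₁ → AgreeOffRow r M M₂ → (∀ j → M r j ≈ M₁ r j + M₂ r j) →
    det n M ≈ det n M₁ + det n M₂
  det-row-additive (suc n) zero {M} {M₁} {M₂} M≈M₁ M≈M₂ M0≈ =
    trans (sum-cong-≋ term-additive) (∑-distrib-+ (laplaceTerm M₁) (laplaceTerm M₂))
    where
    term-additive : ∀ j → laplaceTerm M j ≈ laplaceTerm M₁ j + laplaceTerm M₂ j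
    term-additive j = trans (sign-cong (toℕ j) (begin
      M zero j * det n (minor j M)                               ≈⟨ *-congʳ (M0≈ j) ⟩
      (M₁ zero j + M₂ zero j) * det n (minor j M)                ≈⟨ distribʳ _ _ _ ⟩
      M₁ zero j * det n (minor j M) + M₂ zero j * det n (minor j M)
        ≈⟨ +-cong (*-congˡ (det-cong n λ i c → M≈M₁ (suc i) _ λ ()))
                  (*-congˡ (det-cong n λ i c → M≈M₂ (suc i) _ λ ())) ⟩
      M₁ zero j * det n (minor j M₁) + M₂ zero j * det n (minor j M₂) ∎))
      (sign-+ (toℕ j) _ _)
  det-row-additive (suc n) (suc r) {M} {M₁} {M₂} M≈M₁ M≈M₂ Mr≈ =
    trans (sum-cong-≋ term-additive) (∑-distrib-+ (laplaceTerm M₁) (laplaceTerm M₂))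
    where
    term-additive : ∀ j → laplaceTerm M j ≈ laplaceTerm M₁ j + laplaceTerm M₂ j
    term-additive j = trans (sign-cong (toℕ j) (begin
      M zero j * det n (minor j M)                               ≈⟨ *-congˡ minor-additive ⟩
      M zero j * (det n (minor j M₁) + det n (minor j M₂))       ≈⟨ distribˡ _ _ _ ⟩
      M zero j * det n (minor j M₁) + M zero j * det n (minor j M₂)
        ≈⟨ +-cong (*-congʳ (M≈M₁ zero j λ ())) (*-congʳ (M≈M₂ zero j λ ())) ⟩
      M₁ zero j * det n (minor j M₁) + M₂ zero j * det n (minor j M₂) ∎))
      (sign-+ (toℕ j) _ _)
      where
      minor-additive : det n (minor j M) ≈ det n (minor j M₁) + det n (minor j M₂)
      minor-additive = det-row-additive n r
        (λ i c i≢r → M≈M₁ (suc i) _ (i≢r ∘ Fin.suc-injective))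
        (λ i c i≢r → M≈M₂ (suc i) _ (i≢r ∘ Fin.suc-injective))
        (λ c → Mr≈ _)

  det-row-homogeneous : ∀ n (r : Fin n) (s : A) {M M₁ : Matrix n} →
    AgreeOffRow r M M₁ → (∀ j → M r j ≈ s * M₁ r j) → det n M ≈ s * det n M₁
  det-row-homogeneous (suc n) zero s {M} {M₁} M≈M₁ M0≈ =
    trans (sum-cong-≋ term-homogeneous) (sym (*-distribˡ-sum s (laplaceTerm M₁)))
    where
    term-homogeneous : ∀ j → laplaceTerm M j ≈ s * laplaceTerm M₁ j
    term-homogeneous j = trans (sign-cong (toℕ j) (begin
      M zero j * det n (minor j M)          ≈⟨ *-cong (M0≈ j) (det-cong n λ i c → M≈M₁ (suc i) _ λ ()) ⟩
      (s * M₁ zero j) * det n (minor j M₁)  ≈⟨ *-assoc _ _ _ ⟩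
      s * (M₁ zero j * det n (minor j M₁))  ∎))
      (sign-* (toℕ j) _ _)
  det-row-homogeneous (suc n) (suc r) s {M} {M₁} M≈M₁ Mr≈ =
    trans (sum-cong-≋ term-homogeneous) (sym (*-distribˡ-sum s (laplaceTerm M₁)))
    where
    term-homogeneous : ∀ j → laplaceTerm M j ≈ s * laplaceTerm M₁ j
    term-homogeneous j = trans (sign-cong (toℕ j) (begin
      M zero j * det n (minor j M)          ≈⟨ *-cong (M≈M₁ zero j λ ()) minor-homogeneous ⟩
      M₁ zero j * (s * det n (minor j M₁))  ≈⟨ x∙yz≈y∙xz _ _ _ ⟩
      s * (M₁ zero j * det n (minor j M₁))  ∎))
      (sign-* (toℕ j) _ _)
      where
      minor-homogeneous : det n (minor j M) ≈ s * det n (minor j M₁)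
      minor-homogeneous = det-row-homogeneous n r s
        (λ i c i≢r → M≈M₁ (suc i) _ (i≢r ∘ Fin.suc-injective)) (λ c → Mr≈ _)

  minor-column : {j c : Fin (suc n)} (j≢c : j ≢ c) (M : Matrix (suc n)) (r : Fin n) →
    minor j M r (punchOut j≢c) ≡ M (suc r) c
  minor-column j≢c M r = ≡.cong (M (suc r)) (Fin.punchIn-punchOut j≢c)

  det-column-additive : ∀ n (c : Fin n) {M M₁ M₂ : Matrix n} →
    AgreeOffColumn c M M₁ → AgreeOffColumn c M M₂ → (∀ i → M i c ≈ M₁ i c + M₂ i c) →
    det n M ≈ det n M₁ + det n M₂
  det-column-additive (suc n) c {M} {M₁} {M₂} M≈M₁ M≈M₂ Mc≈ =
    trans (sum-cong-≋ term-additive) (∑-distrib-+ (laplaceTerm M₁) (laplaceTerm M₂))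
    where
    term-additive : ∀ j → laplaceTerm M j ≈ laplaceTerm M₁ j + laplaceTerm M₂ j
    term-additive j with j Fin.≟ c
    ... | yes ≡.refl = trans (sign-cong (toℕ j) (begin
      M zero j * det n (minor j M)                               ≈⟨ *-congʳ (Mc≈ zero) ⟩
      (M₁ zero j + M₂ zero j) * det n (minor j M)                ≈⟨ distribʳ _ _ _ ⟩
      M₁ zero j * det n (minor j M) + M₂ zero j * det n (minor j M)
        ≈⟨ +-cong (*-congˡ (det-cong n λ i x → M≈M₁ _ _ (Fin.punchInᵢ≢i j x)))
                  (*-congˡ (det-cong n λ i x → M≈M₂ _ _ (Fin.punchInᵢ≢i j x))) ⟩
      M₁ zero j * det n (minor j M₁) + M₂ zero j * det n (minor j M₂) ∎))
      (sign-+ (toℕ j) _ _)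
    ... | no j≢c = trans (sign-cong (toℕ j) (begin
      M zero j * det n (minor j M)                               ≈⟨ *-congˡ minor-additive ⟩
      M zero j * (det n (minor j M₁) + det n (minor j M₂))       ≈⟨ distribˡ _ _ _ ⟩
      M zero j * det n (minor j M₁) + M zero j * det n (minor j M₂)
        ≈⟨ +-cong (*-congʳ (M≈M₁ zero j j≢c)) (*-congʳ (M≈M₂ zero j j≢c)) ⟩
      M₁ zero j * det n (minor j M₁) + M₂ zero j * det n (minor j M₂) ∎))
      (sign-+ (toℕ j) _ _)
      where
      minor-additive : det n (minor j M) ≈ det n (minor j M₁) + det n (minor j M₂)
      minor-additive = det-column-additive n (punchOut j≢c)
        (λ i x x≢ → M≈M₁ _ _ (punchIn≢ j≢c x≢))
        (λ i x x≢ → M≈M₂ _ _ (punchIn≢ j≢c x≢))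
        (λ i → begin
          minor j M i (punchOut j≢c)                               ≡⟨ minor-column j≢c M i ⟩
          M (suc i) c                                              ≈⟨ Mc≈ (suc i) ⟩
          M₁ (suc i) c + M₂ (suc i) c                              ≡⟨ ≡.cong₂ _+_ (minor-column j≢c M₁ i) (minor-column j≢c M₂ i) ⟨
          minor j M₁ i (punchOut j≢c) + minor j M₂ i (punchOut j≢c) ∎)

  det-column-homogeneous : ∀ n (c : Fin n) (s : A) {M M₁ : Matrix n} →
    AgreeOffColumn c M M₁ → (∀ i → M i c ≈ s * M₁ i c) → det n M ≈ s * det n M₁
  det-column-homogeneous (suc n) c s {M} {M₁} M≈M₁ Mc≈ =
    trans (sum-cong-≋ term-homogeneous) (sym (*-distribˡ-sum s (laplaceTerm M₁)))
    where
    term-homogeneous : ∀ j → laplaceTerm M j ≈ s * laplaceTerm M₁ j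
    term-homogeneous j with j Fin.≟ c
    ... | yes ≡.refl = trans (sign-cong (toℕ j) (begin
      M zero j * det n (minor j M)          ≈⟨ *-cong (Mc≈ zero) (det-cong n λ i x → M≈M₁ _ _ (Fin.punchInᵢ≢i j x)) ⟩
      (s * M₁ zero j) * det n (minor j M₁)  ≈⟨ *-assoc _ _ _ ⟩
      s * (M₁ zero j * det n (minor j M₁))  ∎))
      (sign-* (toℕ j) _ _)
    ... | no j≢c = trans (sign-cong (toℕ j) (begin
      M zero j * det n (minor j M)          ≈⟨ *-cong (M≈M₁ zero j j≢c) minor-homogeneous ⟩
      M₁ zero j * (s * det n (minor j M₁))  ≈⟨ x∙yz≈y∙xz _ _ _ ⟩
      s * (M₁ zero j * det n (minor j M₁))  ∎))
      (sign-* (toℕ j) _ _)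
      where
      minor-homogeneous : det n (minor j M) ≈ s * det n (minor j M₁)
      minor-homogeneous = det-column-homogeneous n (punchOut j≢c) s
        (λ i x x≢ → M≈M₁ _ _ (punchIn≢ j≢c x≢))
        (λ i → begin
          minor j M i (punchOut j≢c)        ≡⟨ minor-column j≢c M i ⟩
          M (suc i) c                       ≈⟨ Mc≈ (suc i) ⟩
          s * M₁ (suc i) c                  ≡⟨ ≡.cong (s *_) (minor-column j≢c M₁ i) ⟨
          s * minor j M₁ i (punchOut j≢c)   ∎)

  det-adjacent-columns-equal : ∀ n {a b : Fin n} → Adjacent a b → (M : Matrix n) →
    (∀ i → M i a ≈ M i b) → det n M ≈ 0#
  det-adjacent-columns-equal (suc n) {a} {b} a~b M Ma≈Mb =
    ∑-cancel-pair (laplaceTerm M) (Adjacent⇒≢ a~b) other-terms term-b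
    where
    minor-b≈minor-a : minor b M ≈ₘ minor a M
    minor-b≈minor-a r c with punchIn-Adjacent a~b c
    ... | inj₁ eq         = reflexive (≡.cong (M (suc r)) (≡.sym eq))
    ... | inj₂ (eqa , eqb) = begin
      M (suc r) (punchIn b c)  ≡⟨ ≡.cong (M (suc r)) eqb ⟩
      M (suc r) a              ≈⟨ Ma≈Mb (suc r) ⟩
      M (suc r) b              ≡⟨ ≡.cong (M (suc r)) eqa ⟨
      M (suc r) (punchIn a c)  ∎
    term-b : laplaceTerm M b ≈ - laplaceTerm M a
    term-b = begin
      sign (toℕ b) (M zero b * det n (minor b M))         ≡⟨ ≡.cong (λ k → sign k (M zero b * det n (minor b M))) (Adjacent⇒toℕ-suc a~b) ⟩
      sign (suc (toℕ a)) (M zero b * det n (minor b M))   ≈⟨ sign-suc (toℕ a) _ ⟩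
      - sign (toℕ a) (M zero b * det n (minor b M))       ≈⟨ -‿cong (sign-cong (toℕ a) (*-cong (sym (Ma≈Mb zero)) (det-cong n minor-b≈minor-a))) ⟩
      - sign (toℕ a) (M zero a * det n (minor a M))       ∎
    other-terms : ∀ j → j ≢ a → j ≢ b → laplaceTerm M j ≈ 0#
    other-terms j j≢a j≢b = sign-zero (toℕ j) (trans (*-congˡ minor≈0) (zeroʳ _))
      where
      minor≈0 : det n (minor j M) ≈ 0#
      minor≈0 = det-adjacent-columns-equal n (Adjacent-punchOut a~b j≢a j≢b) (minor j M) λ r → begin
        minor j M r (punchOut j≢a)  ≡⟨ minor-column j≢a M r ⟩
        M (suc r) a                 ≈⟨ Ma≈Mb (suc r) ⟩
        M (suc r) b                 ≡⟨ minor-column j≢b M r ⟨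
        minor j M r (punchOut j≢b)  ∎

  -- Equal adjacent rows

  punchIn-punchIn-comm : {j l : Fin (suc (suc n))} (j≢l : j ≢ l) (l≢j : l ≢ j) (c : Fin n) →
    punchIn j (punchIn (punchOut j≢l) c) ≡ punchIn l (punchIn (punchOut l≢j) c)
  punchIn-punchIn-comm {j = zero}  {zero}  j≢l l≢j c       = ⊥-elim (j≢l ≡.refl)
  punchIn-punchIn-comm {j = zero}  {suc l} j≢l l≢j c       = ≡.refl
  punchIn-punchIn-comm {j = suc j} {zero}  j≢l l≢j c       = ≡.refl
  punchIn-punchIn-comm {j = suc j} {suc l} j≢l l≢j zero    = ≡.refl
  punchIn-punchIn-comm {j = suc j} {suc l} j≢l l≢j (suc c) =
    ≡.cong suc (punchIn-punchIn-comm (j≢l ∘ ≡.cong suc) (l≢j ∘ ≡.cong suc) c)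

  sign-suc-suc : ∀ k l x → sign (suc k) (sign (suc l) x) ≈ sign k (sign l x)
  sign-suc-suc k l x = begin
    sign (suc k) (sign (suc l) x)  ≈⟨ sign-suc k _ ⟩
    - sign k (sign (suc l) x)      ≈⟨ -‿cong (sign-cong k (sign-suc l x)) ⟩
    - sign k (- sign l x)          ≈⟨ -‿cong (sign-neg k _) ⟩
    - - sign k (sign l x)          ≈⟨ -‿involutive _ ⟩
    sign k (sign l x)              ∎

  sign-punchOut-anti : {j l : Fin (suc n)} (j≢l : j ≢ l) (l≢j : l ≢ j) (x : A) →
    sign (toℕ j) (sign (toℕ (punchOut j≢l)) x) ≈ - sign (toℕ l) (sign (toℕ (punchOut l≢j)) x)
  sign-punchOut-anti {j = zero}  {zero}  j≢l l≢j x = ⊥-elim (j≢l ≡.refl)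
  sign-punchOut-anti {suc n} {j = zero} {suc l} j≢l l≢j x =
    sym (trans (-‿cong (sign-suc (toℕ l) x)) (-‿involutive _))
  sign-punchOut-anti {suc n} {j = suc j} {zero} j≢l l≢j x = sign-suc (toℕ j) x
  sign-punchOut-anti {suc n} {j = suc j} {suc l} j≢l l≢j x = begin
    sign (suc (toℕ j)) (sign (suc (toℕ (punchOut j≢l′))) x)  ≈⟨ sign-suc-suc (toℕ j) (toℕ (punchOut j≢l′)) x ⟩
    sign (toℕ j) (sign (toℕ (punchOut j≢l′)) x)              ≈⟨ sign-punchOut-anti j≢l′ l≢j′ x ⟩
    - sign (toℕ l) (sign (toℕ (punchOut l≢j′)) x)            ≈⟨ -‿cong (sign-suc-suc (toℕ l) (toℕ (punchOut l≢j′)) x) ⟨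
    - sign (suc (toℕ l)) (sign (suc (toℕ (punchOut l≢j′))) x) ∎
    where
    j≢l′ = j≢l ∘ ≡.cong suc
    l≢j′ = l≢j ∘ ≡.cong suc

  sign-*-sign : ∀ k l x y z → sign k (x * sign l (y * z)) ≈ x * (y * sign k (sign l z))
  sign-*-sign k l x y z =
    trans (sign-* k x _) (*-congˡ (trans (sign-cong k (sign-* l y z)) (sign-* k y _)))

  ∑∑-antisymmetric : (g : Fin n → Fin n → A) → (∀ j → g j j ≈ 0#) → (∀ j l → g j l ≈ - g l j) →
    ∑[ j < n ] ∑[ l < n ] g j l ≈ 0#
  ∑∑-antisymmetric {zero}  g diagonal≈0 anti = refl
  ∑∑-antisymmetric {suc n} g diagonal≈0 anti = begin
    (g zero zero + B) + ∑[ j < n ] (g (suc j) zero + ∑[ l < n ] g (suc j) (suc l))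
      ≈⟨ +-congˡ (∑-distrib-+ (λ j → g (suc j) zero) _) ⟩
    (g zero zero + B) + (C + D)   ≈⟨ +-congʳ (trans (+-congʳ (diagonal≈0 zero)) (+-identityˡ B)) ⟩
    B + (C + D)                   ≈⟨ +-assoc B C D ⟨
    (B + C) + D                   ≈⟨ +-cong B+C≈0 D≈0 ⟩
    0# + 0#                       ≈⟨ +-identityˡ 0# ⟩
    0#                            ∎
    where
    B = ∑[ l < n ] g zero (suc l)
    C = ∑[ j < n ] g (suc j) zero
    D = ∑[ j < n ] ∑[ l < n ] g (suc j) (suc l)
    B+C≈0 : B + C ≈ 0#
    B+C≈0 = trans (sym (∑-distrib-+ (λ l → g zero (suc l)) (λ j → g (suc j) zero)))
                  (∑-zero λ l → trans (+-congʳ (anti zero (suc l))) (-‿inverseˡ _))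
    D≈0 : D ≈ 0#
    D≈0 = ∑∑-antisymmetric (λ j l → g (suc j) (suc l)) (diagonal≈0 ∘ suc) (λ j l → anti (suc j) (suc l))

  module TwoRowExpansion {n} (M : Matrix (suc (suc n))) where

    -- The contribution of columns j (first row) and l (second row) to det M.
    pairTerm : Fin (suc (suc n)) → Fin (suc (suc n)) → A
    pairTerm j l with j Fin.≟ l
    ... | yes _   = 0#
    ... | no j≢l  = sign (toℕ j) (M zero j * sign (toℕ (punchOut j≢l))
                      (M (suc zero) l * det n (minor (punchOut j≢l) (minor j M))))

    pairTerm-diagonal : ∀ j → pairTerm j j ≈ 0#
    pairTerm-diagonal j with j Fin.≟ j
    ... | yes _   = refl
    ... | no j≢j  = ⊥-elim (j≢j ≡.refl)

    pairTerm-punchIn : ∀ j k → pairTerm j (punchIn j k) ≈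
      sign (toℕ j) (M zero j * sign (toℕ k) (M (suc zero) (punchIn j k) * det n (minor k (minor j M))))
    pairTerm-punchIn j k with j Fin.≟ punchIn j k
    ... | yes j≡ = ⊥-elim (Fin.punchInᵢ≢i j k (≡.sym j≡))
    ... | no j≢  = reflexive (≡.cong (λ k′ → sign (toℕ j) (M zero j * sign (toℕ k′)
                     (M (suc zero) (punchIn j k) * det n (minor k′ (minor j M)))))
                     (≡.trans (Fin.punchOut-cong j ≡.refl) (Fin.punchOut-punchIn j)))

    det≈∑∑pairTerm : det (suc (suc n)) M ≈ ∑[ j < suc (suc n) ] ∑[ l < suc (suc n) ] pairTerm j l
    det≈∑∑pairTerm = sum-cong-≋ λ j → begin
      sign (toℕ j) (M zero j * ∑[ k < suc n ] expansion j k)  ≈⟨ sign-cong (toℕ j) (*-distribˡ-sum (M zero j) (expansion j)) ⟩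
      sign (toℕ j) (∑[ k < suc n ] (M zero j * expansion j k)) ≈⟨ sign-sum (toℕ j) (λ k → M zero j * expansion j k) ⟩
      ∑[ k < suc n ] sign (toℕ j) (M zero j * expansion j k)   ≈⟨ sum-cong-≋ (λ k → sym (pairTerm-punchIn j k)) ⟩
      ∑[ k < suc n ] pairTerm j (punchIn j k)                  ≈⟨ +-identityˡ _ ⟨
      0# + ∑[ k < suc n ] pairTerm j (punchIn j k)             ≈⟨ +-congʳ (pairTerm-diagonal j) ⟨
      pairTerm j j + ∑[ k < suc n ] pairTerm j (punchIn j k)   ≈⟨ sum-remove (pairTerm j) ⟨
      ∑[ l < suc (suc n) ] pairTerm j l                        ∎
      where
      expansion : Fin (suc (suc n)) → Fin (suc n) → A
      expansion j k = sign (toℕ k) (M (suc zero) (punchIn j k) * det n (minor k (minor j M)))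

    -- Swapping j and l changes the sign of the term and, when the first two rows
    -- agree, leaves the entries it multiplies unchanged.
    pairTerm-antisymmetric : (∀ j → M zero j ≈ M (suc zero) j) → ∀ j l → pairTerm j l ≈ - pairTerm l j
    pairTerm-antisymmetric rows≈ j l with j Fin.≟ l | l Fin.≟ j
    ... | yes _   | yes _  = sym -0#≈0#
    ... | yes j≡l | no l≢j = ⊥-elim (l≢j (≡.sym j≡l))
    ... | no j≢l  | yes l≡j = ⊥-elim (j≢l (≡.sym l≡j))
    ... | no j≢l  | no l≢j = begin
      sign (toℕ j) (M zero j * sign (toℕ j′) (M (suc zero) l * E))      ≈⟨ sign-*-sign (toℕ j) (toℕ j′) _ _ E ⟩
      M zero j * (M (suc zero) l * sign (toℕ j) (sign (toℕ j′) E))      ≈⟨ *-congˡ (*-congˡ (sign-punchOut-anti j≢l l≢j E)) ⟩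
      M zero j * (M (suc zero) l * - sign (toℕ l) (sign (toℕ l′) E))    ≈⟨ *-congˡ (-‿distribʳ-* _ _) ⟨
      M zero j * - (M (suc zero) l * sign (toℕ l) (sign (toℕ l′) E))    ≈⟨ -‿distribʳ-* _ _ ⟨
      - (M zero j * (M (suc zero) l * sign (toℕ l) (sign (toℕ l′) E)))  ≈⟨ -‿cong (x∙yz≈y∙xz _ _ _) ⟩
      - (M (suc zero) l * (M zero j * sign (toℕ l) (sign (toℕ l′) E)))
        ≈⟨ -‿cong (*-cong (sym (rows≈ l)) (*-cong (rows≈ j) (sign-cong (toℕ l) (sign-cong (toℕ l′) E≈E′)))) ⟩
      - (M zero l * (M (suc zero) j * sign (toℕ l) (sign (toℕ l′) E′))) ≈⟨ -‿cong (sign-*-sign (toℕ l) (toℕ l′) _ _ E′) ⟨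
      - sign (toℕ l) (M zero l * sign (toℕ l′) (M (suc zero) j * E′))   ∎
      where
      j′ = punchOut j≢l
      l′ = punchOut l≢j
      E  = det n (minor j′ (minor j M))
      E′ = det n (minor l′ (minor l M))
      E≈E′ : E ≈ E′
      E≈E′ = det-cong n λ r c → reflexive (≡.cong (M (suc (suc r))) (punchIn-punchIn-comm j≢l l≢j c))

  det-first-rows-equal : ∀ n (M : Matrix (suc (suc n))) → (∀ j → M zero j ≈ M (suc zero) j) →
    det (suc (suc n)) M ≈ 0#
  det-first-rows-equal n M rows≈ =
    trans det≈∑∑pairTerm (∑∑-antisymmetric pairTerm pairTerm-diagonal (pairTerm-antisymmetric rows≈))
    where open TwoRowExpansion M

  det-adjacent-rows-equal : ∀ n {a b : Fin n} → Adjacent a b → (M : Matrix n) →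
    (∀ j → M a j ≈ M b j) → det n M ≈ 0#
  det-adjacent-rows-equal (suc (suc n)) adjacent-zero M rows≈ = det-first-rows-equal n M rows≈
  det-adjacent-rows-equal (suc n) (adjacent-suc a~b) M rows≈ = ∑-zero λ j →
    sign-zero (toℕ j) (trans (*-congˡ (det-adjacent-rows-equal n a~b (minor j M) (λ c → rows≈ _))) (zeroʳ (M zero j)))

  -- Block lower triangular matrices

  punchIn-↑ˡ : ∀ {m} n (j : Fin (suc m)) (c : Fin m) → punchIn (j ↑ˡ n) (c ↑ˡ n) ≡ punchIn j c ↑ˡ n
  punchIn-↑ˡ n zero    c       = ≡.refl
  punchIn-↑ˡ n (suc j) zero    = ≡.refl
  punchIn-↑ˡ n (suc j) (suc c) = ≡.cong suc (punchIn-↑ˡ n j c)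

  punchIn-↑ʳ : ∀ {m n} (j : Fin (suc m)) (c : Fin n) → punchIn (j ↑ˡ n) (m ↑ʳ c) ≡ suc m ↑ʳ c
  punchIn-↑ʳ         zero    c = ≡.refl
  punchIn-↑ʳ {suc m} (suc j) c = ≡.cong suc (punchIn-↑ʳ j c)

  det-block-lower-triangular : ∀ m n (M : Matrix (m ℕ.+ n)) →
    (∀ i c → M (i ↑ˡ n) (m ↑ʳ c) ≈ 0#) →
    det (m ℕ.+ n) M ≈ det m (λ i j → M (i ↑ˡ n) (j ↑ˡ n)) * det n (λ i j → M (m ↑ʳ i) (m ↑ʳ j))
  det-block-lower-triangular zero    n M upper-right≈0 = sym (*-identityˡ _)
  det-block-lower-triangular (suc m) n M upper-right≈0 = begin
    det (suc m ℕ.+ n) M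
      ≈⟨ ∑-split {suc m} {n} (laplaceTerm M) ⟩
    ∑[ j < suc m ] laplaceTerm M (j ↑ˡ n) + ∑[ c < n ] laplaceTerm M (suc m ↑ʳ c)
      ≈⟨ +-congˡ (∑-zero λ c → sign-zero (toℕ (suc m ↑ʳ c)) (trans (*-congʳ (upper-right≈0 zero c)) (zeroˡ _))) ⟩
    ∑[ j < suc m ] laplaceTerm M (j ↑ˡ n) + 0#
      ≈⟨ +-identityʳ _ ⟩
    ∑[ j < suc m ] laplaceTerm M (j ↑ˡ n)
      ≈⟨ sum-cong-≋ left-term ⟩
    ∑[ j < suc m ] (det n D * laplaceTerm A′ j)
      ≈⟨ *-distribˡ-sum (det n D) (laplaceTerm A′) ⟨
    det n D * det (suc m) A′
      ≈⟨ *-comm _ _ ⟩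
    det (suc m) A′ * det n D ∎
    where
    A′ : Matrix (suc m)
    A′ i j = M (i ↑ˡ n) (j ↑ˡ n)
    D : Matrix n
    D i j = M (suc m ↑ʳ i) (suc m ↑ʳ j)
    left-term : ∀ j → laplaceTerm M (j ↑ˡ n) ≈ det n D * laplaceTerm A′ j
    left-term j = begin
      sign (toℕ (j ↑ˡ n)) (M zero (j ↑ˡ n) * det (m ℕ.+ n) (minor (j ↑ˡ n) M))
        ≡⟨ ≡.cong (λ k → sign k (M zero (j ↑ˡ n) * det (m ℕ.+ n) (minor (j ↑ˡ n) M))) (Fin.toℕ-↑ˡ j n) ⟩
      sign (toℕ j) (M zero (j ↑ˡ n) * det (m ℕ.+ n) (minor (j ↑ˡ n) M))
        ≈⟨ sign-cong (toℕ j) (*-congˡ minor≈) ⟩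
      sign (toℕ j) (A′ zero j * (det m (minor j A′) * det n D))
        ≈⟨ sign-cong (toℕ j) (trans (sym (*-assoc _ _ _)) (*-comm _ _)) ⟩
      sign (toℕ j) (det n D * (A′ zero j * det m (minor j A′)))
        ≈⟨ sign-* (toℕ j) _ _ ⟩
      det n D * laplaceTerm A′ j ∎
      where
      minor≈ : det (m ℕ.+ n) (minor (j ↑ˡ n) M) ≈ det m (minor j A′) * det n D
      minor≈ = trans
        (det-block-lower-triangular m n (minor (j ↑ˡ n) M)
          (λ i c → trans (reflexive (≡.cong (M (suc (i ↑ˡ n))) (punchIn-↑ʳ j c))) (upper-right≈0 (suc i) c)))
        (*-cong (det-cong m λ r c → reflexive (≡.cong (M (suc (r ↑ˡ n))) (punchIn-↑ˡ n j c)))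
                (det-cong n λ r c → reflexive (≡.cong (M (suc (m ↑ʳ r))) (punchIn-↑ʳ j c))))

  setRow : Fin n → (Fin n → A) → Matrix n → Matrix n
  setRow r u M i with i Fin.≟ r
  ... | yes _ = u
  ... | no _  = M i

  setRow-≡ : ∀ (r : Fin n) u (M : Matrix n) j → setRow r u M r j ≡ u j
  setRow-≡ r u M j with r Fin.≟ r
  ... | yes _   = ≡.refl
  ... | no r≢r  = ⊥-elim (r≢r ≡.refl)

  setRow-≢ : ∀ {r i : Fin n} u (M : Matrix n) j → i ≢ r → setRow r u M i j ≡ M i j
  setRow-≢ {r = r} {i} u M j i≢r with i Fin.≟ r
  ... | yes i≡r = ⊥-elim (i≢r i≡r)
  ... | no _    = ≡.refl

  setRow-agree : ∀ (r : Fin n) u v (M : Matrix n) → AgreeOffRow r (setRow r u M) (setRow r v M)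
  setRow-agree r u v M i j i≢r = reflexive (≡.trans (setRow-≢ u M j i≢r) (≡.sym (setRow-≢ v M j i≢r)))

  setRow-preserves-agree : ∀ {r} {M M′ : Matrix n} a u →
    AgreeOffRow r M M′ → AgreeOffRow r (setRow a u M) (setRow a u M′)
  setRow-preserves-agree a u M≈M′ i j i≢r with i Fin.≟ a
  ... | yes _ = refl
  ... | no _  = M≈M′ i j i≢r

  swapRows : Fin n → Fin n → Matrix n → Matrix n
  swapRows a b M = setRow a (M b) (setRow b (M a) M)

  -- Alternating multilinear functions of the rows

  record IsAlternatingMultilinear {n} (F : Matrix n → A) : Set (c ⊔ ℓ) where
    field
      cong                : {M M′ : Matrix n} → M ≈ₘ M′ → F M ≈ F M′
      additive            : ∀ r {M M₁ M₂ : Matrix n} → AgreeOffRow r M M₁ → AgreeOffRow r M M₂ →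
                            (∀ j → M r j ≈ M₁ r j + M₂ r j) → F M ≈ F M₁ + F M₂
      homogeneous         : ∀ r s {M M₁ : Matrix n} → AgreeOffRow r M M₁ →
                            (∀ j → M r j ≈ s * M₁ r j) → F M ≈ s * F M₁
      adjacent-rows-equal : {a b : Fin n} → Adjacent a b → (M : Matrix n) →
                            (∀ j → M a j ≈ M b j) → F M ≈ 0#

  det-isAlternatingMultilinear : ∀ n → IsAlternatingMultilinear (det n)
  det-isAlternatingMultilinear n = record
    { cong                = det-cong n
    ; additive            = det-row-additive n
    ; homogeneous         = det-row-homogeneous n
    ; adjacent-rows-equal = det-adjacent-rows-equal n
    }

  det-transpose-isAlternatingMultilinear : ∀ n → IsAlternatingMultilinear (det n ∘ transpose)
  det-transpose-isAlternatingMultilinear n = record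
    { cong                = λ M≈M′ → det-cong n λ i j → M≈M′ j i
    ; additive            = λ r M≈M₁ M≈M₂ Mr≈ →
        det-column-additive n r (λ i j j≢r → M≈M₁ j i j≢r) (λ i j j≢r → M≈M₂ j i j≢r) Mr≈
    ; homogeneous         = λ r s M≈M₁ Mr≈ → det-column-homogeneous n r s (λ i j j≢r → M≈M₁ j i j≢r) Mr≈
    ; adjacent-rows-equal = λ a~b M rows≈ → det-adjacent-columns-equal n a~b (transpose M) rows≈
    }

  module AlternatingMultilinear {n} {F : Matrix n → A} (F-alt : IsAlternatingMultilinear F) where

    open IsAlternatingMultilinear F-alt

    F-setRow-+ : ∀ r M (u v : Fin n → A) →
      F (setRow r (λ j → u j + v j) M) ≈ F (setRow r u M) + F (setRow r v M)
    F-setRow-+ r M u v = additive r (setRow-agree r _ u M) (setRow-agree r _ v M) λ j →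
      reflexive (≡.trans (setRow-≡ r _ M j) (≡.sym (≡.cong₂ _+_ (setRow-≡ r u M j) (setRow-≡ r v M j))))

    F-setRow-* : ∀ r M s (u : Fin n → A) → F (setRow r (λ j → s * u j) M) ≈ s * F (setRow r u M)
    F-setRow-* r M s u = homogeneous r s (setRow-agree r _ u M) λ j →
      reflexive (≡.trans (setRow-≡ r _ M j) (≡.sym (≡.cong (s *_) (setRow-≡ r u M j))))

    F-setRow-∑ : ∀ r M {m} (s : Fin m → A) (w : Fin m → Fin n → A) →
      F (setRow r (λ j → ∑[ l < m ] (s l * w l j)) M) ≈ ∑[ l < m ] (s l * F (setRow r (w l) M))
    F-setRow-∑ r M {zero} s w = trans
      (homogeneous r 0# (setRow-agree r (λ _ → 0#) (λ _ → 0#) M) λ j →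
        trans (reflexive (setRow-≡ r _ M j)) (sym (zeroˡ _)))
      (zeroˡ _)
    F-setRow-∑ r M {suc m} s w = trans (F-setRow-+ r M (λ j → s zero * w zero j) _)
      (+-cong (F-setRow-* r M (s zero) (w zero)) (F-setRow-∑ r M (s ∘ suc) (w ∘ suc)))

    -- Expand F at the matrix whose rows a and b both equal (row a + row b).
    swapRows-adjacent : {a b : Fin n} → Adjacent a b → ∀ M → F (swapRows a b M) ≈ - F M
    swapRows-adjacent {a} {b} a~b M = +-inverseʳ-unique (F M) (F (swapRows a b M)) (begin
      F M + F (swapRows a b M)                   ≈⟨ +-cong (+-identityˡ _) (+-identityʳ _) ⟨
      (0# + F M) + (F (swapRows a b M) + 0#)
        ≈⟨ +-cong (+-cong (sym (equal (M a))) (sym (cong S-a-b≈M))) (+-congˡ (sym (equal (M b)))) ⟩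
      (F (S (M a) (M a)) + F (S (M a) (M b))) + (F (S (M b) (M a)) + F (S (M b) (M b)))
        ≈⟨ +-cong (additive-b (M a)) (additive-b (M b)) ⟨
      F (S (M a) sum-ab) + F (S (M b) sum-ab)    ≈⟨ F-setRow-+ a (setRow b sum-ab M) (M a) (M b) ⟨
      F (S sum-ab sum-ab)                        ≈⟨ equal sum-ab ⟩
      0#                                         ∎)
      where
      b≢a : b ≢ a
      b≢a = Adjacent⇒≢ a~b ∘ ≡.sym
      S : (Fin n → A) → (Fin n → A) → Matrix n
      S u v = setRow a u (setRow b v M)
      S-b : ∀ u v j → S u v b j ≡ v j
      S-b u v j = ≡.trans (setRow-≢ u _ j b≢a) (setRow-≡ b v M j)
      sum-ab : Fin n → A
      sum-ab j = M a j + M b j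
      equal : ∀ u → F (S u u) ≈ 0#
      equal u = adjacent-rows-equal a~b (S u u) λ j → reflexive (≡.trans (setRow-≡ a u _ j) (≡.sym (S-b u u j)))
      additive-b : ∀ u → F (S u sum-ab) ≈ F (S u (M a)) + F (S u (M b))
      additive-b u = additive b
        (setRow-preserves-agree a u (setRow-agree b _ _ M)) (setRow-preserves-agree a u (setRow-agree b _ _ M)) (λ j → reflexive (≡.trans (S-b u sum-ab j) (≡.sym (≡.cong₂ _+_ (S-b u (M a) j) (S-b u (M b) j)))))
      S-a-b≈M : S (M a) (M b) ≈ₘ M
      S-a-b≈M i j with i Fin.≟ a | i Fin.≟ b
      ... | yes ≡.refl | _          = refl
      ... | no _       | yes ≡.refl = reflexive (setRow-≡ b (M b) M j)
      ... | no _       | no i≢b     = reflexive (setRow-≢ (M b) M j i≢b)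

    rows-equal-at-distance : ∀ d {a b : Fin n} → toℕ b ≡ suc (toℕ a ℕ.+ d) → ∀ M →
      (∀ j → M a j ≈ M b j) → F M ≈ 0#
    rows-equal-at-distance zero    {a} {b}     b=a+1 M rows≈ =
      adjacent-rows-equal (toℕ-suc⇒Adjacent (≡.trans b=a+1 (≡.cong suc (ℕₚ.+-identityʳ (toℕ a))))) M rows≈
    rows-equal-at-distance (suc d) {a} {suc b} b=a+d M rows≈ = begin
      F M                    ≈⟨ -‿involutive (F M) ⟨
      - - F M                ≈⟨ -‿cong (swapRows-adjacent b₁~b M) ⟨
      - F (swapRows b₁ (suc b) M) ≈⟨ -‿cong (rows-equal-at-distance d b₁=a+d (swapRows b₁ (suc b) M) swapped-rows≈) ⟩
      - 0#                   ≈⟨ -0#≈0# ⟩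
      0#                     ∎
      where
      b₁ = Fin.inject₁ b
      b₁=a+d : toℕ b₁ ≡ suc (toℕ a ℕ.+ d)
      b₁=a+d = ≡.trans (Fin.toℕ-inject₁ b) (≡.trans (ℕₚ.suc-injective b=a+d) (ℕₚ.+-suc (toℕ a) d))
      b₁~b : Adjacent b₁ (suc b)
      b₁~b = toℕ-suc⇒Adjacent (≡.cong suc (≡.sym (Fin.toℕ-inject₁ b)))
      a≢b₁ : a ≢ b₁
      a≢b₁ a≡b₁ = ℕₚ.m≢1+m+n (toℕ a) (≡.trans (≡.cong toℕ a≡b₁) b₁=a+d)
      a≢b : a ≢ suc b
      a≢b a≡b = ℕₚ.m≢1+m+n (toℕ a) (≡.trans (≡.cong toℕ a≡b) b=a+d)
      swapped-rows≈ : ∀ j → swapRows b₁ (suc b) M a j ≈ swapRows b₁ (suc b) M b₁ j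
      swapped-rows≈ j = begin
        swapRows b₁ (suc b) M a j  ≡⟨ ≡.trans (setRow-≢ _ _ j a≢b₁) (setRow-≢ _ M j a≢b) ⟩
        M a j                      ≈⟨ rows≈ j ⟩
        M (suc b) j                ≡⟨ setRow-≡ b₁ _ _ j ⟨
        swapRows b₁ (suc b) M b₁ j ∎

    rows-equal : {a b : Fin n} → a ≢ b → ∀ M → (∀ j → M a j ≈ M b j) → F M ≈ 0#
    rows-equal {a} {b} a≢b M rows≈ with ℕₚ.<-cmp (toℕ a) (toℕ b)
    ... | tri< a<b _ _ = let d , a+d≡b = ℕₚ.m≤n⇒∃[o]m+o≡n a<b in rows-equal-at-distance d (≡.sym a+d≡b) M rows≈
    ... | tri≈ _ a≡b _ = ⊥-elim (a≢b (Fin.toℕ-injective a≡b))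
    ... | tri> _ _ b<a = let d , b+d≡a = ℕₚ.m≤n⇒∃[o]m+o≡n b<a in rows-equal-at-distance d (≡.sym b+d≡a) M (sym ∘ rows≈)

    add-row-combination : ∀ r {m} (g : Fin m → Fin n) (s : Fin m → A) {M M′ : Matrix n} →
      (∀ l → g l ≡ r → s l ≈ 0#) → AgreeOffRow r M′ M →
      (∀ j → M′ r j ≈ M r j + ∑[ l < m ] (s l * M (g l) j)) → F M′ ≈ F M
    add-row-combination r {m} g s {M} {M′} s≈0 M′≈M M′r≈ = begin
      F M′
        ≈⟨ additive r M′≈M (λ i j i≢r → trans (M′≈M i j i≢r) (sym (reflexive (setRow-≢ _ M j i≢r))))
                           (λ j → trans (M′r≈ j) (+-congˡ (sym (reflexive (setRow-≡ r _ M j))))) ⟩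
      F M + F (setRow r (λ j → ∑[ l < m ] (s l * M (g l) j)) M)
        ≈⟨ +-congˡ (F-setRow-∑ r M s (M ∘ g)) ⟩
      F M + ∑[ l < m ] (s l * F (setRow r (M (g l)) M))      ≈⟨ +-congˡ (∑-zero term≈0) ⟩
      F M + 0#                                               ≈⟨ +-identityʳ (F M) ⟩
      F M                                                    ∎
      where
      term≈0 : ∀ l → s l * F (setRow r (M (g l)) M) ≈ 0#
      term≈0 l with g l Fin.≟ r
      ... | yes gl≡r = trans (*-congʳ (s≈0 l gl≡r)) (zeroˡ _)
      ... | no gl≢r  = trans (*-congˡ (rows-equal (gl≢r ∘ ≡.sym) (setRow r (M (g l)) M) λ j →
                         reflexive (≡.trans (setRow-≡ r _ M j) (≡.sym (setRow-≢ _ M j gl≢r))))) (zeroʳ _)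

    -- The rows are modified one at a time, in increasing order.
    add-fixed-row-combinations : ∀ {m} (g : Fin m → Fin n) (t : Fin n → Fin m → A) {M M′ : Matrix n} →
      (∀ l l′ → t (g l) l′ ≈ 0#) →
      (∀ i j → M′ i j ≈ M i j + ∑[ l < m ] (t i l * M (g l) j)) → F M′ ≈ F M
    add-fixed-row-combinations {m} g t {M} {M′} sources-fixed M′≈ =
      trans (cong M′≈prefix-n) (prefix≈ n ℕₚ.≤-refl)
      where
      prefix : ℕ → Matrix n
      prefix k i with toℕ i ℕ.<? k
      ... | yes _ = M′ i
      ... | no _  = M i

      M′≈prefix-n : M′ ≈ₘ prefix n
      M′≈prefix-n i j with toℕ i ℕ.<? n
      ... | yes _   = refl
      ... | no i≮n  = ⊥-elim (i≮n (Fin.toℕ<n i))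

      prefix-0≈M : prefix 0 ≈ₘ M
      prefix-0≈M i j with toℕ i ℕ.<? 0
      ... | no _ = refl

      source-unchanged : ∀ k l j → prefix k (g l) j ≈ M (g l) j
      source-unchanged k l j with toℕ (g l) ℕ.<? k
      ... | no _  = refl
      ... | yes _ = begin
        M′ (g l) j                                        ≈⟨ M′≈ (g l) j ⟩
        M (g l) j + ∑[ l′ < m ] (t (g l) l′ * M (g l′) j) ≈⟨ +-congˡ (∑-zero λ l′ → trans (*-congʳ (sources-fixed l l′)) (zeroˡ _)) ⟩
        M (g l) j + 0#                                    ≈⟨ +-identityʳ _ ⟩
        M (g l) j                                         ∎

      prefix≈ : ∀ k → k ℕ.≤ n → F (prefix k) ≈ F M
      prefix≈ zero    _   = cong prefix-0≈M
      prefix≈ (suc k) k<n = trans step (prefix≈ k (ℕₚ.<⇒≤ k<n))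
        where
        i₀ = Fin.fromℕ< k<n
        i₀≡k : toℕ i₀ ≡ k
        i₀≡k = Fin.toℕ-fromℕ< k<n
        agree : AgreeOffRow i₀ (prefix (suc k)) (prefix k)
        agree i j i≢i₀ with toℕ i ℕ.<? suc k | toℕ i ℕ.<? k
        ... | yes _     | yes _   = refl
        ... | no _      | no _    = refl
        ... | yes i<1+k | no i≮k  =
          ⊥-elim (i≢i₀ (Fin.toℕ-injective (≡.trans (ℕₚ.≤-antisym (ℕₚ.≤-pred i<1+k) (ℕₚ.≮⇒≥ i≮k)) (≡.sym i₀≡k))))
        ... | no i≮1+k  | yes i<k = ⊥-elim (i≮1+k (ℕₚ.m<n⇒m<1+n i<k))
        at-i₀ : ∀ j → prefix (suc k) i₀ j ≈ prefix k i₀ j + ∑[ l < m ] (t i₀ l * prefix k (g l) j)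
        at-i₀ j with toℕ i₀ ℕ.<? suc k | toℕ i₀ ℕ.<? k
        ... | _          | yes i₀<k = ⊥-elim (ℕₚ.<-irrefl i₀≡k i₀<k)
        ... | no i₀≮1+k  | no _     = ⊥-elim (i₀≮1+k (ℕₚ.≤-reflexive (≡.cong suc i₀≡k)))
        ... | yes _      | no _     =
          trans (M′≈ i₀ j) (+-congˡ (sum-cong-≋ λ l → *-congˡ (sym (source-unchanged k l j))))
        step : F (prefix (suc k)) ≈ F (prefix k)
        step = add-row-combination i₀ g (t i₀)
          (λ l gl≡i₀ → trans (reflexive (≡.cong (λ i → t i l) (≡.sym gl≡i₀))) (sources-fixed l l))
          agree at-i₀

module CollatzResidues where
  open import Defs using (T; indicator; collatzMatrix)
  open import Data.Bool using (true; false; if_then_else_)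
  open import Data.Fin using (Fin; toℕ)
  open import Data.Nat using (ℕ; zero; suc; _+_; _*_; _%_; _/_; _≡ᵇ_; _<_; s≤s; NonZero)
  open import Data.Nat.Divisibility using (_∣_; divides; m%n≡0⇒n∣m; n∣m⇒m%n≡0; ∣m⇒∣m*n)
  open import Data.Nat.DivMod
  import Data.Nat.Properties as ℕ
  open import Data.Nat.Tactic.RingSolver using (solve-∀)
  open import Data.Product using (_×_; _,_)
  open import Data.Sum using (_⊎_; inj₁; inj₂)
  open import Data.Empty using (⊥-elim)
  open import Function using (_∘_)
  open import Relation.Binary.PropositionalEquality
  open ≡-Reasoning
  open import Algebra.Properties.CommutativeMonoid.Sum ℕ.+-0-commutativeMonoid
    using (sum; sum-syntax; sum-cong-≗; sum-replicate-zero; ∑-distrib-+)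

  -- T with the parity of its argument supplied separately: T n = T-step (n % 2) n.
  private
    T-step : ℕ → ℕ → ℕ
    T-step p n = if p ≡ᵇ 0 then n / 2 else (3 * n + 1) / 2

    T-step-+2m : ∀ m .{{_ : NonZero m}} p n → T-step p (n + m * 2) % m ≡ T-step p n % m
    T-step-+2m m p n with p ≡ᵇ 0
    ... | true = begin
      (n + m * 2) / 2 % m      ≡⟨ cong (_% m) (+-distrib-/-∣ʳ n (divides m refl)) ⟩
      (n / 2 + m * 2 / 2) % m  ≡⟨ cong (λ x → (n / 2 + x) % m) (m*n/n≡m m 2) ⟩
      (n / 2 + m) % m          ≡⟨ [m+n]%n≡m%n (n / 2) m ⟩
      n / 2 % m                ∎
    ... | false = begin
      (3 * (n + m * 2) + 1) / 2 % m            ≡⟨ cong (λ x → x / 2 % m) (3[n+2m]+1 n m) ⟩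
      ((3 * n + 1) + (3 * m) * 2) / 2 % m      ≡⟨ cong (_% m) (+-distrib-/-∣ʳ (3 * n + 1) (divides (3 * m) refl)) ⟩
      ((3 * n + 1) / 2 + (3 * m) * 2 / 2) % m  ≡⟨ cong (λ x → ((3 * n + 1) / 2 + x) % m) (m*n/n≡m (3 * m) 2) ⟩
      ((3 * n + 1) / 2 + 3 * m) % m            ≡⟨ [m+kn]%n≡m%n ((3 * n + 1) / 2) 3 m ⟩
      (3 * n + 1) / 2 % m                      ∎
      where
      3[n+2m]+1 : ∀ n m → 3 * (n + m * 2) + 1 ≡ (3 * n + 1) + (3 * m) * 2
      3[n+2m]+1 = solve-∀

  T[n+2m]%m≡T[n]%m : ∀ m .{{_ : NonZero m}} n → T (n + m * 2) % m ≡ T n % m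
  T[n+2m]%m≡T[n]%m m n = begin
    T-step ((n + m * 2) % 2) (n + m * 2) % m  ≡⟨ cong (λ p → T-step p (n + m * 2) % m) ([m+kn]%n≡m%n n m 2) ⟩
    T-step (n % 2) (n + m * 2) % m            ≡⟨ T-step-+2m m (n % 2) n ⟩
    T-step (n % 2) n % m                      ∎

  T[n+qm]%m≡T[n+[q%2]m]%m : ∀ m .{{_ : NonZero m}} n q → T (n + q * m) % m ≡ T (n + (q % 2) * m) % m
  T[n+qm]%m≡T[n+[q%2]m]%m m n q = begin
    T (n + q * m) % m                          ≡⟨ cong (λ x → T (n + x * m) % m) (m≡m%n+[m/n]*n q 2) ⟩
    T (n + (q % 2 + (q / 2) * 2) * m) % m      ≡⟨ cong (λ x → T x % m) (regroup n (q % 2) (q / 2) m) ⟩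
    T ((n + (q % 2) * m) + (q / 2) * (m * 2)) % m ≡⟨ periodic (n + (q % 2) * m) (q / 2) ⟩
    T (n + (q % 2) * m) % m                    ∎
    where
    regroup : ∀ n r h m → n + (r + h * 2) * m ≡ (n + r * m) + h * (m * 2)
    regroup = solve-∀
    periodic : ∀ n t → T (n + t * (m * 2)) % m ≡ T n % m
    periodic n zero    = cong (λ x → T x % m) (ℕ.+-identityʳ n)
    periodic n (suc t) = begin
      T (n + (m * 2 + t * (m * 2))) % m     ≡⟨ cong (λ x → T x % m) (shuffle n t m) ⟩
      T (n + t * (m * 2) + m * 2) % m       ≡⟨ T[n+2m]%m≡T[n]%m m (n + t * (m * 2)) ⟩
      T (n + t * (m * 2)) % m               ≡⟨ periodic n t ⟩
      T n % m                               ∎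
      where
      shuffle : ∀ n t m → n + (m * 2 + t * (m * 2)) ≡ n + t * (m * 2) + m * 2
      shuffle = solve-∀

  %2≡0⊎%2≡1 : ∀ q → q % 2 ≡ 0 ⊎ q % 2 ≡ 1
  %2≡0⊎%2≡1 q with q % 2 | m%n<n q 2
  ... | 0           | _                 = inj₁ refl
  ... | 1           | _                 = inj₂ refl
  ... | suc (suc _) | s≤s (s≤s ())

  odd-cofactor : ∀ {N} q m → N % 2 ≡ 1 → N ≡ q * m → q % 2 ≡ 1
  odd-cofactor {N} q m N-odd N≡qm with %2≡0⊎%2≡1 q
  ... | inj₂ q-odd  = q-odd
  ... | inj₁ q-even = ⊥-elim (ℕ.0≢1+n (trans (sym N-even) N-odd))
    where
    N-even : N % 2 ≡ 0
    N-even = n∣m⇒m%n≡0 N 2 (subst (2 ∣_) (sym N≡qm) (∣m⇒∣m*n m (m%n≡0⇒n∣m q 2 q-even)))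

  -- T modulo N₀ depends only on its argument modulo 2N₀, and since k is odd the
  -- pairs {a, a + k N₀} and {a % N₀, a % N₀ + N₀} agree modulo 2N₀.
  private
    module TPair (N₀ : ℕ) .{{_ : NonZero N₀}} (k : ℕ) (k-odd : k % 2 ≡ 1) (a : ℕ) where
      a₀ = a % N₀
      q  = a / N₀

      T-at : ℕ → ℕ
      T-at r = T (a₀ + r * N₀) % N₀

      T-at-0 : T-at 0 ≡ T a₀ % N₀
      T-at-0 = cong (λ x → T x % N₀) (ℕ.+-identityʳ a₀)

      T-at-1 : T-at 1 ≡ T (a₀ + N₀) % N₀
      T-at-1 = cong (λ x → T (a₀ + x) % N₀) (ℕ.*-identityˡ N₀)

      first : T a % N₀ ≡ T-at (q % 2)
      first = trans (cong (λ x → T x % N₀) (m≡m%n+[m/n]*n a N₀)) (T[n+qm]%m≡T[n+[q%2]m]%m N₀ a₀ q)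

      second : T (a + k * N₀) % N₀ ≡ T-at ((q % 2 + 1) % 2)
      second = begin
        T (a + k * N₀) % N₀               ≡⟨ cong (λ x → T (x + k * N₀) % N₀) (m≡m%n+[m/n]*n a N₀) ⟩
        T (a₀ + q * N₀ + k * N₀) % N₀     ≡⟨ cong (λ x → T x % N₀) (regroup a₀ q k N₀) ⟩
        T (a₀ + (q + k) * N₀) % N₀        ≡⟨ T[n+qm]%m≡T[n+[q%2]m]%m N₀ a₀ (q + k) ⟩
        T-at ((q + k) % 2)                ≡⟨ cong T-at (trans (%-distribˡ-+ q k 2) (cong (λ x → (q % 2 + x) % 2) k-odd)) ⟩
        T-at ((q % 2 + 1) % 2)            ∎
        where
        regroup : ∀ a₀ q k N₀ → a₀ + q * N₀ + k * N₀ ≡ a₀ + (q + k) * N₀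
        regroup = solve-∀

      images : q % 2 ≡ 0 ⊎ q % 2 ≡ 1 →
        (T a % N₀ ≡ T a₀ % N₀ × T (a + k * N₀) % N₀ ≡ T (a₀ + N₀) % N₀) ⊎
        (T a % N₀ ≡ T (a₀ + N₀) % N₀ × T (a + k * N₀) % N₀ ≡ T a₀ % N₀)
      images (inj₁ q-even) = inj₁ (trans first (trans (cong T-at q-even) T-at-0) ,
                                   trans second (trans (cong (λ r → T-at ((r + 1) % 2)) q-even) T-at-1))
      images (inj₂ q-odd)  = inj₂ (trans first (trans (cong T-at q-odd) T-at-1) ,
                                   trans second (trans (cong (λ r → T-at ((r + 1) % 2)) q-odd) T-at-0))

  T-pair-mod : ∀ N₀ .{{_ : NonZero N₀}} k → k % 2 ≡ 1 → ∀ a →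
    (T a % N₀ ≡ T (a % N₀) % N₀ × T (a + k * N₀) % N₀ ≡ T (a % N₀ + N₀) % N₀) ⊎
    (T a % N₀ ≡ T (a % N₀ + N₀) % N₀ × T (a + k * N₀) % N₀ ≡ T (a % N₀) % N₀)
  T-pair-mod N₀ k k-odd a = TPair.images N₀ k k-odd a (%2≡0⊎%2≡1 (a / N₀))

  collatzEntry : (N : ℕ) .{{_ : NonZero N}} → ℕ → ℕ → ℕ
  collatzEntry N a c = indicator (T a % N ≡ᵇ c) + indicator (T (a + N) % N ≡ᵇ c)

  collatzMatrix≡collatzEntry : ∀ N .{{_ : NonZero N}} (i j : Fin N) →
    collatzMatrix N i j ≡ collatzEntry N (toℕ i) (toℕ j)
  collatzMatrix≡collatzEntry (suc m) i j = refl

  ∑-indicator-≡ᵇ : ∀ n (p : ℕ → ℕ) {x} → x < n → ∑[ z < n ] (p (toℕ z) * indicator (x ≡ᵇ toℕ z)) ≡ p x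
  ∑-indicator-≡ᵇ (suc n) p {zero} _ = begin
    p 0 * 1 + ∑[ z < n ] (p (suc (toℕ z)) * 0)
      ≡⟨ cong₂ _+_ (ℕ.*-identityʳ (p 0)) (sum-cong-≗ {n} {λ z → p (suc (toℕ z)) * 0} λ z → ℕ.*-zeroʳ (p (suc (toℕ z)))) ⟩
    p 0 + ∑[ z < n ] 0                          ≡⟨ cong (p 0 +_) (sum-replicate-zero n) ⟩
    p 0 + 0                                     ≡⟨ ℕ.+-identityʳ (p 0) ⟩
    p 0                                         ∎
  ∑-indicator-≡ᵇ (suc n) p {suc x} (s≤s x<n) =
    trans (cong (_+ ∑[ z < n ] (p (suc (toℕ z)) * indicator (x ≡ᵇ toℕ z))) (ℕ.*-zeroʳ (p 0))) (∑-indicator-≡ᵇ n (p ∘ suc) x<n)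

  collatzEntry-residue-sum : ∀ N₀ .{{_ : NonZero N₀}} k → k % 2 ≡ 1 → ∀ N .{{_ : NonZero N}} → N ≡ k * N₀ → ∀ a c →
    ∑[ z < N ] (indicator (toℕ z % N₀ ≡ᵇ c) * collatzEntry N a (toℕ z)) ≡ collatzEntry N₀ (a % N₀) c
  collatzEntry-residue-sum N₀ k k-odd N N≡kN₀ a c = begin
    ∑[ z < N ] (p (toℕ z) * collatzEntry N a (toℕ z))
      ≡⟨ sum-cong-≗ {N} (λ z → ℕ.*-distribˡ-+ (p (toℕ z)) (image a z) (image (a + N) z)) ⟩
    ∑[ z < N ] (p (toℕ z) * image a z + p (toℕ z) * image (a + N) z)
      ≡⟨ ∑-distrib-+ {N} (λ z → p (toℕ z) * image a z) (λ z → p (toℕ z) * image (a + N) z) ⟩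
    ∑[ z < N ] (p (toℕ z) * image a z) + ∑[ z < N ] (p (toℕ z) * image (a + N) z)
      ≡⟨ cong₂ _+_ (∑-indicator-≡ᵇ N p (m%n<n (T a) N)) (∑-indicator-≡ᵇ N p (m%n<n (T (a + N)) N)) ⟩
    p (T a % N) + p (T (a + N) % N)
      ≡⟨ cong₂ _+_ (cong q (m∣n⇒o%n%m≡o%m N₀ N (T a) N₀∣N)) (cong q (m∣n⇒o%n%m≡o%m N₀ N (T (a + N)) N₀∣N)) ⟩
    q (T a % N₀) + q (T (a + N) % N₀)
      ≡⟨ cong (λ x → q (T a % N₀) + q (T (a + x) % N₀)) N≡kN₀ ⟩
    q (T a % N₀) + q (T (a + k * N₀) % N₀)
      ≡⟨ by-pairing (T-pair-mod N₀ k k-odd a) ⟩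
    q (T (a % N₀) % N₀) + q (T (a % N₀ + N₀) % N₀) ∎
    where
    q p : ℕ → ℕ
    q x = indicator (x ≡ᵇ c)
    p x = q (x % N₀)
    image : ℕ → Fin N → ℕ
    image ν z = indicator (T ν % N ≡ᵇ toℕ z)
    N₀∣N : N₀ ∣ N
    N₀∣N = divides k N≡kN₀
    by-pairing : ∀ {x y u v} → (x ≡ u × y ≡ v) ⊎ (x ≡ v × y ≡ u) → q x + q y ≡ q u + q v
    by-pairing (inj₁ (refl , refl)) = refl
    by-pairing {x} {y} (inj₂ (refl , refl)) = ℕ.+-comm (q x) (q y)

module CharacteristicPolynomial where
  open import Defs hiding (det)
  import Defs
  open PolynomialRing using (Poly-commutativeRing; coeffwise; coeff-≡)
  open Determinant Poly-commutativeRing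
  open CollatzResidues using (collatzEntry; collatzMatrix≡collatzEntry; collatzEntry-residue-sum)

  open import Data.Bool using (true; false) renaming (T to True)
  open import Data.Empty using (⊥-elim)
  open import Data.Fin as Fin using (Fin; zero; suc; toℕ; _↑ˡ_; _↑ʳ_)
  import Data.Fin.Properties as Fin
  open import Data.Integer as ℤ using (+_)
  import Data.Integer.Properties as ℤ
  open import Data.List using ([])
  open import Data.Nat as ℕ using (ℕ; _%_; _≡ᵇ_; _≤ᵇ_; _<ᵇ_; NonZero)
  import Data.Nat.Properties as ℕₚ
  open import Data.Nat.DivMod using ([m+kn]%n≡m%n; m<n⇒m%n≡m; m%n<n)
  open import Data.Product using (_,_)
  open import Data.Unit using (tt)
  open import Function using (_∘_)
  open import Relation.Nullary using (¬_; yes; no)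
  open import Relation.Binary.PropositionalEquality as ≡ using (_≡_; _≢_)

  open CommutativeRing Poly-commutativeRing hiding (zero)
  open import Algebra.Properties.Ring ring using (-0#≈0#; -‿distribʳ-*; -1*x≈-x)
  open import Algebra.Properties.Semiring.Sum semiring using (sum; sum-syntax; sum-cong-≋; ∑-distrib-+)
  open import Algebra.Properties.CommutativeMonoid.Sum ℕₚ.+-0-commutativeMonoid using (sum-cong-≗) renaming (sum to ℕ-sum)
  open import Relation.Binary.Reasoning.Setoid setoid

  sumP≡sum : ∀ n (f : Fin n → Poly) → sumP n f ≡ sum f
  sumP≡sum ℕ.zero    f = ≡.refl
  sumP≡sum (ℕ.suc n) f = ≡.cong (f zero +P_) (sumP≡sum n (f ∘ suc))

  signP≡sign : ∀ k p → signP k p ≡ sign k p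
  signP≡sign ℕ.zero             p = ≡.refl
  signP≡sign (ℕ.suc ℕ.zero)     p = ≡.refl
  signP≡sign (ℕ.suc (ℕ.suc k))  p = signP≡sign k p

  Defs-det≈det : ∀ n M → Defs.det n M ≈ det n M
  Defs-det≈det ℕ.zero    M = refl
  Defs-det≈det (ℕ.suc n) M = trans (reflexive (sumP≡sum (ℕ.suc n) term)) (sum-cong-≋ λ j →
    trans (reflexive (signP≡sign (toℕ j) _)) (sign-cong (toℕ j) (*-congˡ {M zero j} (Defs-det≈det n (minor j M)))))
    where
    term : Fin (ℕ.suc n) → Poly
    term j = signP (toℕ j) (M zero j *P Defs.det n (minor j M))

  ι : ℕ → Poly
  ι a = constP (+ a)

  ι-0 : ι 0 ≈ 0#
  ι-0 = coeffwise λ { ℕ.zero → ≡.refl ; (ℕ.suc k) → ≡.refl }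

  ι-+ : ∀ a b → ι (a ℕ.+ b) ≈ ι a + ι b
  ι-+ a b = coeffwise λ { ℕ.zero → ℤ.pos-+ a b ; (ℕ.suc k) → ≡.refl }

  ι-* : ∀ a b → ι (a ℕ.* b) ≈ ι a * ι b
  ι-* a b = coeffwise λ
    { ℕ.zero → ≡.trans (ℤ.pos-* a b) (≡.sym (ℤ.+-identityʳ _))
    ; (ℕ.suc ℕ.zero) → ≡.refl
    ; (ℕ.suc (ℕ.suc k)) → ≡.refl }

  ι-∑ : ∀ n (f : Fin n → ℕ) → ι (ℕ-sum f) ≈ ∑[ j < n ] ι (f j)
  ι-∑ ℕ.zero    f = ι-0
  ι-∑ (ℕ.suc n) f = trans (ι-+ (f zero) _) (+-congˡ {ι (f zero)} (ι-∑ n (f ∘ suc)))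

  indicator-true : ∀ {b} → True b → indicator b ≡ 1
  indicator-true {true} _ = ≡.refl

  indicator-false : ∀ {b} → ¬ True b → indicator b ≡ 0
  indicator-false {true}  ¬b = ⊥-elim (¬b tt)
  indicator-false {false} _  = ≡.refl

  ≢⇒¬≡ᵇ : ∀ {x y} → x ≢ y → ¬ True (x ≡ᵇ y)
  ≢⇒¬≡ᵇ {x} {y} x≢y = x≢y ∘ ℕₚ.≡ᵇ⇒≡ x y

  ι-indicator-≡ : ∀ {x y} → x ≡ y → ι (indicator (x ≡ᵇ y)) ≈ 1#
  ι-indicator-≡ {x} {y} x≡y = reflexive (≡.cong ι (indicator-true (ℕₚ.≡⇒≡ᵇ x y x≡y)))

  ι-indicator-≢ : ∀ {x y} → x ≢ y → ι (indicator (x ≡ᵇ y)) ≈ 0#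
  ι-indicator-≢ x≢y = trans (reflexive (≡.cong ι (indicator-false (≢⇒¬≡ᵇ x≢y)))) ι-0

  identityEntry-≡ : ∀ {n} (i : Fin n) → identityEntry i i ≡ X
  identityEntry-≡ i with i Fin.≟ i
  ... | yes _   = ≡.refl
  ... | no i≢i  = ⊥-elim (i≢i ≡.refl)

  identityEntry-≢ : ∀ {n} {i j : Fin n} → i ≢ j → identityEntry i j ≡ []
  identityEntry-≢ {i = i} {j} i≢j with i Fin.≟ j
  ... | yes i≡j = ⊥-elim (i≢j i≡j)
  ... | no _    = ≡.refl

  ι-indicator-*≈0 : ∀ {b} n → ¬ True b → ι (indicator b ℕ.* n) ≈ 0#
  ι-indicator-*≈0 n ¬b = trans (reflexive (≡.cong (λ x → ι (x ℕ.* n)) (indicator-false ¬b))) ι-0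

  ι-*-indicator≈0 : ∀ {b} n → ¬ True b → ι (n ℕ.* indicator b) ≈ 0#
  ι-*-indicator≈0 n ¬b =
    trans (reflexive (≡.cong ι (≡.trans (≡.cong (n ℕ.*_) (indicator-false ¬b)) (ℕₚ.*-zeroʳ n)))) ι-0

  charMatrix : ∀ n → Matrix n
  charMatrix n i j = identityEntry i j -P ι (collatzMatrix n i j)

  module Factorisation (N₀ kp : ℕ) .{{_ : NonZero N₀}} (k-odd : ℕ.suc kp % 2 ≡ 1) where

    K N : ℕ
    K = kp ℕ.* N₀
    N = K ℕ.+ N₀

    instance
      N-nonZero : NonZero N
      N-nonZero = ℕ.>-nonZero (ℕₚ.<-≤-trans (ℕ.>-nonZero⁻¹ N₀) (ℕₚ.m≤n+m N₀ K))

    N≡kN₀ : N ≡ ℕ.suc kp ℕ.* N₀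
    N≡kN₀ = ℕₚ.+-comm K N₀

    residue-↑ʳ : ∀ (c : Fin N₀) → toℕ (K ↑ʳ c) % N₀ ≡ toℕ c
    residue-↑ʳ c = ≡.trans (≡.cong (_% N₀) (≡.trans (Fin.toℕ-↑ʳ K c) (ℕₚ.+-comm K (toℕ c))))
      (≡.trans ([m+kn]%n≡m%n (toℕ c) kp N₀) (m<n⇒m%n≡m (Fin.toℕ<n c)))

    M : Matrix N
    M = charMatrix N

    -- Column K + c receives every column j < K with j ≡ c (mod N₀).
    w : Fin N → Fin K → Poly
    w z j = ι (indicator (K ≤ᵇ toℕ z) ℕ.* indicator (toℕ j % N₀ ≡ᵇ toℕ z % N₀))

    M₁ : Matrix N
    M₁ i z = M i z + ∑[ j < K ] (w z j * M i (j ↑ˡ N₀))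

    -- Row i < K loses row K + (i % N₀).
    s : Fin N → Fin N₀ → Poly
    s i r = - ι (indicator (toℕ i <ᵇ K) ℕ.* indicator (toℕ r ≡ᵇ toℕ i % N₀))

    M₂ : Matrix N
    M₂ i z = M₁ i z + ∑[ r < N₀ ] (s i r * M₁ (K ↑ʳ r) z)

    w-↑ˡ≈0 : ∀ j j′ → w (j ↑ˡ N₀) j′ ≈ 0#
    w-↑ˡ≈0 j j′ = ι-indicator-*≈0 _ λ K≤j →
      ℕₚ.<⇒≱ (≡.subst (ℕ._< K) (≡.sym (Fin.toℕ-↑ˡ j N₀)) (Fin.toℕ<n j)) (ℕₚ.≤ᵇ⇒≤ K _ K≤j)

    s-↑ʳ≈0 : ∀ r r′ → s (K ↑ʳ r) r′ ≈ 0#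
    s-↑ʳ≈0 r r′ = trans (-‿cong (ι-indicator-*≈0 _ λ r<K →
      ℕₚ.<⇒≱ (ℕₚ.<ᵇ⇒< _ K r<K) (≡.subst (K ℕ.≤_) (≡.sym (Fin.toℕ-↑ʳ K r)) (ℕₚ.m≤m+n K (toℕ r))))) -0#≈0#

    classColumn : ℕ → ℕ → Poly
    classColumn ρ c = ι (indicator (ρ ≡ᵇ c)) * X + - ι (collatzEntry N₀ ρ c)

    residue-column-sum : ∀ i (c : Fin N₀) →
      ∑[ z < N ] (ι (indicator (toℕ z % N₀ ≡ᵇ toℕ c)) * M i z) ≈ classColumn (toℕ i % N₀) (toℕ c)
    residue-column-sum i c = begin
      ∑[ z < N ] (v z * (identityEntry i z + - ι (C z)))
        ≈⟨ sum-cong-≋ (λ z → trans (distribˡ (v z) (identityEntry i z) (- ι (C z)))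
                                    (+-congˡ {v z * identityEntry i z} (sym (-‿distribʳ-* (v z) (ι (C z)))))) ⟩
      ∑[ z < N ] (v z * identityEntry i z + - (v z * ι (C z)))
        ≈⟨ ∑-distrib-+ (λ z → v z * identityEntry i z) (λ z → - (v z * ι (C z))) ⟩
      ∑[ z < N ] (v z * identityEntry i z) + ∑[ z < N ] (- (v z * ι (C z)))
        ≈⟨ +-cong identity-part (∑-neg (λ z → v z * ι (C z))) ⟩
      v i * X + - ∑[ z < N ] (v z * ι (C z))
        ≈⟨ +-congˡ {v i * X} (-‿cong collatz-part) ⟩
      classColumn (toℕ i % N₀) (toℕ c) ∎
      where
      v : Fin N → Poly
      v z = ι (indicator (toℕ z % N₀ ≡ᵇ toℕ c))
      C : Fin N → ℕ
      C z = collatzMatrix N i z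
      identity-part : ∑[ z < N ] (v z * identityEntry i z) ≈ v i * X
      identity-part = trans
        (∑-single _ i λ z z≢i → trans (*-congˡ {v z} (reflexive (identityEntry-≢ (z≢i ∘ ≡.sym)))) (zeroʳ (v z)))
        (*-congˡ {v i} (reflexive (identityEntry-≡ i)))
      collatz-part : ∑[ z < N ] (v z * ι (C z)) ≈ ι (collatzEntry N₀ (toℕ i % N₀) (toℕ c))
      collatz-part = begin
        ∑[ z < N ] (v z * ι (C z))
          ≈⟨ sum-cong-≋ (λ z → sym (ι-* (indicator (toℕ z % N₀ ≡ᵇ toℕ c)) (C z))) ⟩
        ∑[ z < N ] ι (indicator (toℕ z % N₀ ≡ᵇ toℕ c) ℕ.* C z)
          ≈⟨ ι-∑ N _ ⟨
        ι (ℕ-sum λ z → indicator (toℕ z % N₀ ≡ᵇ toℕ c) ℕ.* C z)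
          ≡⟨ ≡.cong ι (≡.trans (sum-cong-≗ {N} λ z → ≡.cong (indicator (toℕ z % N₀ ≡ᵇ toℕ c) ℕ.*_) (collatzMatrix≡collatzEntry N i z))
               (collatzEntry-residue-sum N₀ (ℕ.suc kp) k-odd N N≡kN₀ (toℕ i) (toℕ c))) ⟩
        ι (collatzEntry N₀ (toℕ i % N₀) (toℕ c)) ∎

    M₁-↑ʳ : ∀ i (c : Fin N₀) → M₁ i (K ↑ʳ c) ≈ classColumn (toℕ i % N₀) (toℕ c)
    M₁-↑ʳ i c = begin
      M i (K ↑ʳ c) + ∑[ j < K ] (w (K ↑ʳ c) j * M i (j ↑ˡ N₀))
        ≈⟨ +-cong (sym right-part) (sum-cong-≋ λ j → *-congʳ {M i (j ↑ˡ N₀)} (w≈v j)) ⟩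
      ∑[ c′ < N₀ ] (v (K ↑ʳ c′) * M i (K ↑ʳ c′)) + ∑[ j < K ] (v (j ↑ˡ N₀) * M i (j ↑ˡ N₀))
        ≈⟨ +-comm (∑[ c′ < N₀ ] (v (K ↑ʳ c′) * M i (K ↑ʳ c′))) (∑[ j < K ] (v (j ↑ˡ N₀) * M i (j ↑ˡ N₀))) ⟩
      ∑[ j < K ] (v (j ↑ˡ N₀) * M i (j ↑ˡ N₀)) + ∑[ c′ < N₀ ] (v (K ↑ʳ c′) * M i (K ↑ʳ c′))
        ≈⟨ ∑-split {K} {N₀} (λ z → v z * M i z) ⟨
      ∑[ z < N ] (v z * M i z)
        ≈⟨ residue-column-sum i c ⟩
      classColumn (toℕ i % N₀) (toℕ c) ∎
      where
      v : Fin N → Poly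
      v z = ι (indicator (toℕ z % N₀ ≡ᵇ toℕ c))
      right-part : ∑[ c′ < N₀ ] (v (K ↑ʳ c′) * M i (K ↑ʳ c′)) ≈ M i (K ↑ʳ c)
      right-part = trans
        (∑-single _ c λ c′ c′≢c → trans (*-congʳ {M i (K ↑ʳ c′)} (ι-indicator-≢ λ c′≡c →
          c′≢c (Fin.toℕ-injective (≡.trans (≡.sym (residue-↑ʳ c′)) c′≡c)))) (zeroˡ (M i (K ↑ʳ c′))))
        (trans (*-congʳ {M i (K ↑ʳ c)} (ι-indicator-≡ (residue-↑ʳ c))) (*-identityˡ _))
      w≈v : ∀ j → w (K ↑ʳ c) j ≈ v (j ↑ˡ N₀)
      w≈v j = reflexive (≡.cong ι (≡.trans
        (≡.cong₂ ℕ._*_ (indicator-true (ℕₚ.≤⇒≤ᵇ (≡.subst (K ℕ.≤_) (≡.sym (Fin.toℕ-↑ʳ K c)) (ℕₚ.m≤m+n K (toℕ c)))))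
                       (≡.cong (λ x → indicator (toℕ j % N₀ ≡ᵇ x)) (residue-↑ʳ c)))
        (≡.trans (ℕₚ.*-identityˡ _) (≡.cong (λ x → indicator (x % N₀ ≡ᵇ toℕ c)) (≡.sym (Fin.toℕ-↑ˡ j N₀))))))

    M₂-↑ˡ-↑ʳ≈0 : ∀ (i : Fin K) (c : Fin N₀) → M₂ (i ↑ˡ N₀) (K ↑ʳ c) ≈ 0#
    M₂-↑ˡ-↑ʳ≈0 i c = begin
      M₁ (i ↑ˡ N₀) (K ↑ʳ c) + ∑[ r < N₀ ] (s (i ↑ˡ N₀) r * M₁ (K ↑ʳ r) (K ↑ʳ c))
        ≈⟨ +-cong (M₁-↑ʳ (i ↑ˡ N₀) c) (∑-single _ r₀ other-rows≈0) ⟩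
      classColumn ρ (toℕ c) + s (i ↑ˡ N₀) r₀ * M₁ (K ↑ʳ r₀) (K ↑ʳ c)
        ≈⟨ +-congˡ {classColumn ρ (toℕ c)} (*-cong s-r₀≈-1 (M₁-↑ʳ (K ↑ʳ r₀) c)) ⟩
      classColumn ρ (toℕ c) + - 1# * classColumn (toℕ (K ↑ʳ r₀) % N₀) (toℕ c)
        ≈⟨ +-congˡ {classColumn ρ (toℕ c)} (trans (-1*x≈-x _)
             (reflexive (≡.cong (λ x → - classColumn x (toℕ c)) (≡.trans (residue-↑ʳ r₀) r₀≡ρ)))) ⟩
      classColumn ρ (toℕ c) + - classColumn ρ (toℕ c)
        ≈⟨ -‿inverseʳ (classColumn ρ (toℕ c)) ⟩
      0# ∎
      where
      ρ = toℕ (i ↑ˡ N₀) % N₀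
      r₀ : Fin N₀
      r₀ = Fin.fromℕ< (m%n<n (toℕ (i ↑ˡ N₀)) N₀)
      r₀≡ρ : toℕ r₀ ≡ ρ
      r₀≡ρ = Fin.toℕ-fromℕ< (m%n<n (toℕ (i ↑ˡ N₀)) N₀)
      i<K : toℕ (i ↑ˡ N₀) ℕ.< K
      i<K = ≡.subst (ℕ._< K) (≡.sym (Fin.toℕ-↑ˡ i N₀)) (Fin.toℕ<n i)
      s-r₀≈-1 : s (i ↑ˡ N₀) r₀ ≈ - 1#
      s-r₀≈-1 = -‿cong (reflexive (≡.cong ι (≡.cong₂ ℕ._*_ (indicator-true (ℕₚ.<⇒<ᵇ i<K)) (indicator-true (ℕₚ.≡⇒≡ᵇ _ _ r₀≡ρ)))))
      other-rows≈0 : ∀ r → r ≢ r₀ → s (i ↑ˡ N₀) r * M₁ (K ↑ʳ r) (K ↑ʳ c) ≈ 0#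
      other-rows≈0 r r≢r₀ = trans (*-congʳ {M₁ (K ↑ʳ r) (K ↑ʳ c)}
        (trans (-‿cong (ι-*-indicator≈0 (indicator (toℕ (i ↑ˡ N₀) <ᵇ K)) (≢⇒¬≡ᵇ r≢ρ))) -0#≈0#))
        (zeroˡ (M₁ (K ↑ʳ r) (K ↑ʳ c)))
        where
        r≢ρ : toℕ r ≢ ρ
        r≢ρ r≡ρ = r≢r₀ (Fin.toℕ-injective (≡.trans r≡ρ (≡.sym r₀≡ρ)))

    M₂-↑ʳ-↑ʳ : ∀ (r c : Fin N₀) → M₂ (K ↑ʳ r) (K ↑ʳ c) ≈ charMatrix N₀ r c
    M₂-↑ʳ-↑ʳ r c = begin
      M₁ (K ↑ʳ r) (K ↑ʳ c) + ∑[ r′ < N₀ ] (s (K ↑ʳ r) r′ * M₁ (K ↑ʳ r′) (K ↑ʳ c))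
        ≈⟨ +-congˡ {M₁ (K ↑ʳ r) (K ↑ʳ c)} (∑-zero λ r′ →
             trans (*-congʳ {M₁ (K ↑ʳ r′) (K ↑ʳ c)} (s-↑ʳ≈0 r r′)) (zeroˡ (M₁ (K ↑ʳ r′) (K ↑ʳ c)))) ⟩
      M₁ (K ↑ʳ r) (K ↑ʳ c) + 0#
        ≈⟨ +-identityʳ _ ⟩
      M₁ (K ↑ʳ r) (K ↑ʳ c)
        ≈⟨ M₁-↑ʳ (K ↑ʳ r) c ⟩
      classColumn (toℕ (K ↑ʳ r) % N₀) (toℕ c)
        ≡⟨ ≡.cong (λ x → classColumn x (toℕ c)) (residue-↑ʳ r) ⟩
      ι (indicator (toℕ r ≡ᵇ toℕ c)) * X + - ι (collatzEntry N₀ (toℕ r) (toℕ c))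
        ≈⟨ +-cong identity-part (reflexive (≡.cong (λ x → - ι x) (≡.sym (collatzMatrix≡collatzEntry N₀ r c)))) ⟩
      identityEntry r c + - ι (collatzMatrix N₀ r c) ∎
      where
      identity-part : ι (indicator (toℕ r ≡ᵇ toℕ c)) * X ≈ identityEntry r c
      identity-part with r Fin.≟ c
      ... | yes ≡.refl = trans (*-congʳ {X} (ι-indicator-≡ {toℕ r} ≡.refl)) (*-identityˡ X)
      ... | no r≢c     = trans (*-congʳ {X} (ι-indicator-≢ (r≢c ∘ Fin.toℕ-injective))) (zeroˡ X)

    D : Matrix K
    D i j = M₂ (i ↑ˡ N₀) (j ↑ˡ N₀)

    charPoly≈ : charPoly N ≈ det K D * charPoly N₀
    charPoly≈ = begin
      Defs.det N M        ≈⟨ Defs-det≈det N M ⟩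
      det N M             ≈⟨ AlternatingMultilinear.add-fixed-row-combinations
                               (det-transpose-isAlternatingMultilinear N) (_↑ˡ N₀) w w-↑ˡ≈0 (λ z i → refl) ⟨
      det N M₁            ≈⟨ AlternatingMultilinear.add-fixed-row-combinations
                               (det-isAlternatingMultilinear N) (K ↑ʳ_) s s-↑ʳ≈0 (λ i z → refl) ⟨
      det N M₂            ≈⟨ det-block-lower-triangular K N₀ M₂ M₂-↑ˡ-↑ʳ≈0 ⟩
      det K D * det N₀ (λ r c → M₂ (K ↑ʳ r) (K ↑ʳ c))
                          ≈⟨ *-congˡ {det K D} (det-cong N₀ M₂-↑ʳ-↑ʳ) ⟩
      det K D * det N₀ (charMatrix N₀)
                          ≈⟨ *-congˡ {det K D} (Defs-det≈det N₀ (charMatrix N₀)) ⟨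
      det K D * charPoly N₀ ∎

    charPoly∣charPoly : charPoly N₀ ∣P charPoly N
    charPoly∣charPoly = det K D , trans charPoly≈ (*-comm (det K D) (charPoly N₀)) .coeff-≡

  charPoly∣charPoly-odd-multiple : ∀ N₀ .{{_ : NonZero N₀}} q → q % 2 ≡ 1 → charPoly N₀ ∣P charPoly (q ℕ.* N₀)
  charPoly∣charPoly-odd-multiple N₀ (ℕ.suc kp) q-odd =
    ≡.subst (λ n → charPoly N₀ ∣P charPoly n) (ℕₚ.+-comm (kp ℕ.* N₀) N₀) (Factorisation.charPoly∣charPoly N₀ kp q-odd)

open import Relation.Binary.PropositionalEquality using (subst; sym)
open CollatzResidues using (odd-cofactor)
open CharacteristicPolynomial using (charPoly∣charPoly-odd-multiple)

lemma2p10 : (N N₀ : ℕ) → N % 2 ≡ 1 → 0 < N₀ → N₀ ∣ N →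
    charPoly N₀ ∣P charPoly N
lemma2p10 N N₀@(suc _) N-odd _ (divides q N≡qN₀) =
  subst (λ n → charPoly N₀ ∣P charPoly n) (sym N≡qN₀)
    (charPoly∣charPoly-odd-multiple N₀ q (odd-cofactor q N₀ N-odd N≡qN₀))
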